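{- Let $n\ge1$ and let $\sigma\in S_n(321)$ have no fixed points. Let $(P,Q)$ be the pair of tableaux obtained from $\sigma$ by the Robinson–Schensted–Knuth correspondence, and let $\Phi(\sigma)\in\mathcal{D}_n$ and the matching be as defined below. Then the following quantities are all equal: (1) the number of matched pairs $(X_i,X_j)$ ($X_i$ an excedance, $X_j$ an antiexcedance); (2) the length of the second row of $P$ (equivalently of $Q$); (3) the number of right-side tunnels of $\Phi(\sigma)$; (4) the number of left-side tunnels of $\Phi(\sigma)$; (5) $\tfrac12\bigl(n-\mathrm{he}(\Phi(\sigma))\bigr)$; (6) $n-\ell(\sigma)$.
   Context: $S_n(321)$ is the set of permutations of $\{1,\dots,n\}$ with no $a<b<c$ such that $\sigma(a)>\sigma(b)>\sigma(c)$. $\ell(\sigma)$ is the length of the longest increasing subsequence. $X_i$ denotes the point $(i,\sigma(i))$; $i$ (or $X_i$) is an excedance if $\sigma(i)>i$ and an antiexcedance if $\sigma(i)<i$. Matching: let $\sigma(i_1)<\dots<\sigma(i_k)$ be the values at the excedances and $\sigma(j_1)<\dots<\sigma(j_{n-k})$ the values at the antiexcedances. Set $a=1,b=1$ and repeat until $a>k$ or $b>n-k$: if $i_a>j_b$, set $b:=b+1$ ($X_{j_b}$ unmatched); else if $\sigma(i_a)<\sigma(j_b)$, set $a:=a+1$ ($X_{i_a}$ unmatched); else match $X_{i_a}$ with $X_{j_b}$ and set $a:=a+1$, $b:=b+1$. All excedances/antiexcedances not matched in this process are unmatched. Dyck paths: $\mathcal{D}_n$ is the set of words in $u$ (step $(1,1)$)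 and $d$ (step $(1,-1)$) with $n$ of each and every prefix having at least as many $u$'s as $d$'s. A tunnel of $D$ is a decomposition $D=AuBdC$ with $B$ a Dyck word (possibly empty), viewed as the horizontal segment from the start of $u$ (at $x=|A|$) to the end of $d$ (at $x=|A|+|B|+2$). It is a right tunnel if $|A|>|C|$ and a left tunnel if $|A|<|C|$. A right-side tunnel is a right tunnel lying entirely in $x\ge n$ (i.e. $|A|\ge n$); a left-side tunnel is a left tunnel lying entirely in $x\le n$ (i.e. $|A|+|B|+2\le n$). $\mathrm{he}(D)$ is the height of the path at $x=n$. $\Phi(\sigma)$: with $(P,Q)$ the RSK insertion and recording tableaux of $\sigma$ (at most two rows), let $A$ be the word whose $i$-th letter is $u$ if $i$ is in the first row of $P$ and $d$ if in the second row, $B$ the analogous word from $Q$; $\Phi(\sigma)$ is $A$ followed by the reversal of $B$. -}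

module Defs where

open import Data.Nat using (ℕ; zero; suc; _+_; _∸_; _<ᵇ_; _≡ᵇ_; _⊔_)
open import Data.Bool using (Bool; true; false; if_then_else_; _∧_; not)
open import Data.List using (List; []; _∷_; _++_; map; length; reverse; take; filter; foldr; concatMap)
open import Data.Bool.ListAction using (any)
open import Data.Maybe using (Maybe; just; nothing)
open import Data.Product using (_×_; _,_; proj₁; proj₂)
open import Data.Fin using (Fin; toℕ; _<_)
open import Data.Fin.Permutation using (Permutation′; _⟨$⟩ʳ_; _⟨$⟩ˡ_)
open import Data.Integer using (ℤ; +_; _-_)
open import Data.List using (allFin)
open import Relation.Nullary using (¬_)
open import Relation.Binary.PropositionalEquality using (_≡_)

-- Conventions: positions and values are 0-based (Fin n); all notions used
-- (fixed points, excedances, order comparisons, RSK) are invariant under the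
-- shift {1..n} → {0..n-1}.

Avoids321 : ∀ {n} → Permutation′ n → Set
Avoids321 {n} σ = (a b c : Fin n) → a < b → b < c →
  ¬ ((σ ⟨$⟩ʳ b) < (σ ⟨$⟩ʳ a) × (σ ⟨$⟩ʳ c) < (σ ⟨$⟩ʳ b))

FixedPointFree : ∀ {n} → Permutation′ n → Set
FixedPointFree {n} σ = (i : Fin n) → ¬ (σ ⟨$⟩ʳ i ≡ i)

oneLine : ∀ {n} → Permutation′ n → List ℕ
oneLine {n} σ = map (λ i → toℕ (σ ⟨$⟩ʳ i)) (allFin n)

sublists : List ℕ → List (List ℕ)
sublists [] = [] ∷ []
sublists (x ∷ xs) = let r = sublists xs in map (x ∷_) r ++ r

increasing : List ℕ → Bool
increasing [] = true
increasing (x ∷ []) = true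
increasing (x ∷ y ∷ ys) = (x <ᵇ y) ∧ increasing (y ∷ ys)

maximum : List ℕ → ℕ
maximum = foldr _⊔_ 0

lis : ∀ {n} → Permutation′ n → ℕ
lis σ = maximum (map length (filter (λ s → Data.Bool.T? (increasing s)) (sublists (oneLine σ))))
  where import Data.Bool

excedances : ∀ {n} → Permutation′ n → List (ℕ × ℕ)
excedances {n} σ = concatMap pick (allFin n)
  where
  pick : Fin n → List (ℕ × ℕ)
  pick v = let i = σ ⟨$⟩ˡ v in
    if toℕ i <ᵇ toℕ v then (toℕ i , toℕ v) ∷ [] else []

antiexcedances : ∀ {n} → Permutation′ n → List (ℕ × ℕ)
antiexcedances {n} σ = concatMap pick (allFin n)
  where
  pick : Fin n → List (ℕ × ℕ)
  pick v = let j = σ ⟨$⟩ˡ v in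
    if toℕ v <ᵇ toℕ j then (toℕ j , toℕ v) ∷ [] else []

matchCount : List (ℕ × ℕ) → List (ℕ × ℕ) → ℕ
matchCount [] _ = 0
matchCount (_ ∷ _) [] = 0
matchCount ((i , si) ∷ es) ((j , sj) ∷ as) =
  if j <ᵇ i then matchCount ((i , si) ∷ es) as
  else if si <ᵇ sj then matchCount es ((j , sj) ∷ as)
  else suc (matchCount es as)

matchedPairs : ∀ {n} → Permutation′ n → ℕ
matchedPairs σ = matchCount (excedances σ) (antiexcedances σ)

Tableau : Set
Tableau = List (List ℕ)

insertRow : ℕ → List ℕ → Maybe ℕ × List ℕ
insertRow x [] = nothing , x ∷ []
insertRow x (y ∷ ys) =
  if x <ᵇ y then (just y , x ∷ ys)
  else (proj₁ (insertRow x ys) , y ∷ proj₂ (insertRow x ys))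

insertT : ℕ → Tableau → Tableau × ℕ
insertT x [] = (x ∷ []) ∷ [] , 0
insertT x (r ∷ rs) with insertRow x r
... | nothing , r′ = r′ ∷ rs , 0
... | just y , r′ with insertT y rs
...   | rs′ , k = r′ ∷ rs′ , suc k

addAt : ℕ → ℕ → Tableau → Tableau
addAt x zero [] = (x ∷ []) ∷ []
addAt x zero (r ∷ rs) = (r ++ x ∷ []) ∷ rs
addAt x (suc k) [] = [] ∷ addAt x k []
addAt x (suc k) (r ∷ rs) = r ∷ addAt x k rs

rsFrom : ℕ → List ℕ → Tableau × Tableau → Tableau × Tableau
rsFrom pos [] pq = pq
rsFrom pos (x ∷ xs) (P , Q) with insertT x P
... | P′ , k = rsFrom (suc pos) xs (P′ , addAt pos k Q)

RSK : ∀ {n} → Permutation′ n → Tableau × Tableau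
RSK σ = rsFrom 0 (oneLine σ) ([] , [])

rowLength : ℕ → Tableau → ℕ
rowLength _ [] = 0
rowLength zero (r ∷ _) = length r
rowLength (suc k) (_ ∷ rs) = rowLength k rs

data Step : Set where
  u d : Step

dyckFrom : ℕ → List Step → Bool
dyckFrom h [] = h ≡ᵇ 0
dyckFrom h (u ∷ s) = dyckFrom (suc h) s
dyckFrom zero (d ∷ s) = false
dyckFrom (suc h) (d ∷ s) = dyckFrom h s

isDyck : List Step → Bool
isDyck = dyckFrom 0

splits : {A : Set} → List A → List (List A × List A)
splits [] = ([] , []) ∷ []
splits (x ∷ xs) = ([] , x ∷ xs) ∷ map (λ p → (x ∷ proj₁ p , proj₂ p)) (splits xs)

-- all tunnels D = A u B d C (B a Dyck word), recorded as (A , B , C)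
tunnels : List Step → List (List Step × List Step × List Step)
tunnels D = concatMap fromA (splits D)
  where
  fromB : List Step → List Step × List Step → List (List Step × List Step × List Step)
  fromB A (B , d ∷ C) = if isDyck B then (A , B , C) ∷ [] else []
  fromB A (B , u ∷ C) = []
  fromB A (B , [])    = []
  fromA : List Step × List Step → List (List Step × List Step × List Step)
  fromA (A , u ∷ R) = concatMap (fromB A) (splits R)
  fromA (A , _)     = []

rightSideTunnels : ℕ → List Step → ℕ
rightSideTunnels n D = length (filter (λ t → Data.Bool.T? (ok t)) (tunnels D))
  where
  import Data.Bool
  ok : List Step × List Step × List Step → Bool
  ok (A , B , C) = (length C <ᵇ length A) ∧ not (length A <ᵇ n)

leftSideTunnels : ℕ → List Step → ℕ
leftSideTunnels n D = length (filter (λ t → Data.Bool.T? (ok t)) (tunnels D))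
  where
  import Data.Bool
  ok : List Step × List Step × List Step → Bool
  ok (A , B , C) = (length A <ᵇ length C) ∧ not (n <ᵇ length A + length B + 2)

count : Step → List Step → ℕ
count s [] = 0
count u (u ∷ w) = suc (count u w)
count u (d ∷ w) = count u w
count d (u ∷ w) = count d w
count d (d ∷ w) = suc (count d w)

he : ℕ → List Step → ℤ
he n D = + count u (take n D) - + count d (take n D)

memberB : ℕ → List ℕ → Bool
memberB x = any (x ≡ᵇ_)

firstRow : Tableau → List ℕ
firstRow [] = []
firstRow (r ∷ _) = r

rowWord : ℕ → Tableau → List Step
rowWord n T = map (λ i → if memberB (toℕ i) (firstRow T) then u else d) (allFin n)

flip : Step → Step
flip u = d
flip d = u

reversal : List Step → List Step
reversal w = reverse (map flip w)

Φ : ∀ {n} → Permutation′ n → List Step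
Φ {n} σ = rowWord n (proj₁ (RSK σ)) ++ reversal (rowWord n (proj₂ (RSK σ)))

-- For σ avoiding 321, Robinson–Schensted never creates a third row: a letter bumped
-- out of the first row exceeds the whole second row, for otherwise it would close a
-- 321 pattern.  Schensted's invariant (the longest increasing subsequence with values
-- below v is as long as the part of the first row below v) gives ℓ(σ) = |row 1|, so
-- |row 2| = n − ℓ(σ).  The excedance points and the antiexcedance points each form a
-- chain, and following the matching procedure, the longest chain of their union gains
-- one for every unmatched point (it precedes everything left) and one for every matched
-- pair (the two are incomparable, but one of them precedes a longest chain of the rest);
-- hence ℓ(σ) = n − #matched pairs.  Finally Φ(σ) is the ballot word of P followed by the
-- reversed ballot word of Q: its height at n is |row 1| − |row 2|, the tunnels inside a
-- ballot word correspond to its down steps, and those inside a reversed ballot word to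
-- its up steps.

module Submission where

open import Defs
open import Data.Nat using (ℕ; zero; suc; _+_; _∸_; _*_; _⊔_; _<ᵇ_; _≡ᵇ_; _≤_; _<_; _≤?_; _<?_; z≤n; s≤s; s≤s⁻¹)
open import Data.Nat.Properties
open import Algebra.Properties.CommutativeSemigroup +-commutativeSemigroup using (xy∙z≈xz∙y; x∙yz≈zx∙y; xy∙z≈yz∙x; interchange)
open import Data.Bool using (Bool; true; false; if_then_else_; T; not; _∧_)
import Data.Bool as Bool
open import Data.Bool.Properties using (T-∧)
open import Data.Empty using (⊥; ⊥-elim)
open import Data.Fin using (Fin; toℕ)
import Data.Fin as F
open import Data.Fin.Permutation using (Permutation′; _⟨$⟩ʳ_; _⟨$⟩ˡ_; inverseˡ; inverseʳ)
open import Data.Fin.Properties using (toℕ-injective; toℕ<n; toℕ-fromℕ<)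
import Data.Integer as ℤ
open import Data.Integer.Properties using (pos-+; pos-*)
open import Data.Integer.Tactic.RingSolver using (solve-∀)
open import Data.List using (List; []; _∷_; _++_; _∷ʳ_; [_]; map; length; filter; concatMap; applyUpTo; applyDownFrom; allFin; tabulate; take; reverse)
open import Data.List.Membership.DecPropositional _≟_ using (_∈?_)
open import Data.List.Membership.Propositional using (_∈_; _∉_; find)
open import Data.List.Membership.Propositional.Properties
open import Data.List.Properties
open import Data.List.Relation.Binary.Sublist.Propositional using (_⊆_; []; _∷_; minimum; from∈; ⊆-refl; ⊆-trans)
  renaming (_∷ʳ_ to skip)
open import Data.List.Relation.Binary.Sublist.Propositional.Properties using (++⁺; ++⁺ʳ; length-mono-≤; All-resp-⊆; Any-resp-⊆; map⁺)
open import Data.List.Relation.Unary.All as All using (All; []; _∷_; all?)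
open import Data.List.Relation.Unary.All.Properties using (¬All⇒Any¬; ∷ʳ⁺; ∷ʳ⁻)
import Data.List.Relation.Unary.All.Properties as Allₚ
open import Data.List.Relation.Unary.AllPairs as AllPairs using (AllPairs; []; _∷_)
import Data.List.Relation.Unary.AllPairs.Properties as AllPairsₚ
open import Data.List.Relation.Unary.Any as Any using (Any; here; there)
open import Data.Maybe using (just; nothing)
open import Data.Product using (∃-syntax; _×_; _,_; proj₁; proj₂; map₂)
open import Data.Product.Properties using () renaming (≡-dec to ×-≡-dec)
open import Data.Sum using (_⊎_; inj₁; inj₂; [_,_]′)
import Data.Sum as Sum
open import Data.Unit using (⊤; tt)
open import Function using (_∘_; id)
open import Function.Bundles using (Equivalence)
open import Relation.Binary using (tri<; tri≈; tri>)
open import Relation.Binary.PropositionalEquality hiding ([_])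
open import Relation.Nullary using (¬_; Dec; yes; no; contradiction; _×-dec_)
open import Relation.Unary using (Decidable)

<ᵇ-true : ∀ {m n} → m < n → (m <ᵇ n) ≡ true
<ᵇ-true {m} {n} m<n with m <ᵇ n | <⇒<ᵇ m<n
... | true | _ = refl

<ᵇ-false : ∀ {m n} → n ≤ m → (m <ᵇ n) ≡ false
<ᵇ-false {m} {n} n≤m with m <ᵇ n in eq
... | false = refl
... | true = contradiction n≤m (<⇒≱ (<ᵇ⇒< m n (subst T (sym eq) tt)))

not-<ᵇ⇒≥ : ∀ {m n} → T (not (m <ᵇ n)) → n ≤ m
not-<ᵇ⇒≥ t = ≮⇒≥ (λ m<n → subst (T ∘ not) (<ᵇ-true m<n) t)

≥⇒not-<ᵇ : ∀ {m n} → n ≤ m → T (not (m <ᵇ n))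
≥⇒not-<ᵇ n≤m = subst (T ∘ not) (sym (<ᵇ-false n≤m)) tt

memberB-∈ : ∀ {x} xs → T (memberB x xs) → x ∈ xs
memberB-∈ {x} (a ∷ xs) t with x ≡ᵇ a in eq
... | true = here (≡ᵇ⇒≡ x a (subst T (sym eq) tt))
... | false = there (memberB-∈ xs t)

∈-memberB : ∀ {x} xs → x ∈ xs → memberB x xs ≡ true
∈-memberB {x} (a ∷ xs) (here refl) with x ≡ᵇ x | ≡⇒≡ᵇ x x refl
... | true | _ = refl
∈-memberB {x} (a ∷ xs) (there x∈) with x ≡ᵇ a
... | true = refl
... | false = ∈-memberB xs x∈

∉-memberB : ∀ {x} xs → x ∉ xs → memberB x xs ≡ false
∉-memberB {x} xs x∉ with memberB x xs in eq
... | true = contradiction (memberB-∈ xs (subst T (sym eq) tt)) x∉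
... | false = refl

-- Opaque, so that unification treats countBelow k xs as rigid instead of unfolding filter.
opaque
  countBelow : ℕ → List ℕ → ℕ
  countBelow k xs = length (filter (_<? k) xs)

  countBelow-[] : ∀ k → countBelow k [] ≡ 0
  countBelow-[] k = refl

  countBelow-< : ∀ {a k} xs → a < k → countBelow k (a ∷ xs) ≡ suc (countBelow k xs)
  countBelow-< xs a<k = cong length (filter-accept (_<? _) a<k)

  countBelow-≥ : ∀ {a k} xs → k ≤ a → countBelow k (a ∷ xs) ≡ countBelow k xs
  countBelow-≥ xs k≤a = cong length (filter-reject (_<? _) (≤⇒≯ k≤a))

  countBelow-++ : ∀ k xs ys → countBelow k (xs ++ ys) ≡ countBelow k xs + countBelow k ys
  countBelow-++ k xs ys = trans (cong length (filter-++ (_<? k) xs ys)) (length-++ (filter (_<? k) xs))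

  countBelow-all : ∀ {k xs} → All (_< k) xs → countBelow k xs ≡ length xs
  countBelow-all all< = cong length (filter-all (_<? _) all<)

  countBelow-none : ∀ {k xs} → All (k ≤_) xs → countBelow k xs ≡ 0
  countBelow-none {k} {xs} all≥ = cong length (filter-none (_<? k) {xs} (All.map ≤⇒≯ all≥))

  countBelow-∷-cong : ∀ {k xs ys} a → countBelow k xs ≡ countBelow k ys → countBelow k (a ∷ xs) ≡ countBelow k (a ∷ ys)
  countBelow-∷-cong {k} {xs} {ys} a eq with a <? k
  ... | yes a<k = trans (countBelow-< xs a<k) (trans (cong suc eq) (sym (countBelow-< ys a<k)))
  ... | no a≮k = trans (countBelow-≥ xs (≮⇒≥ a≮k)) (trans eq (sym (countBelow-≥ ys (≮⇒≥ a≮k))))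

  countBelow-zero : ∀ xs → countBelow 0 xs ≡ 0
  countBelow-zero xs = cong length (filter-none (_<? 0) {xs} (All.tabulate λ _ ()))

  countBelow-mono : ∀ {j k} xs → j ≤ k → countBelow j xs ≤ countBelow k xs
  countBelow-mono [] j≤k = z≤n
  countBelow-mono {j} {k} (a ∷ xs) j≤k with a <? j | a <? k
  ... | yes a<j | yes a<k = subst₂ _≤_ (sym (countBelow-< xs a<j)) (sym (countBelow-< xs a<k)) (s≤s (countBelow-mono xs j≤k))
  ... | yes a<j | no a≮k = contradiction (<-≤-trans a<j j≤k) a≮k
  ... | no a≮j | yes a<k = subst₂ _≤_ (sym (countBelow-≥ xs (≮⇒≥ a≮j))) (sym (countBelow-< xs a<k)) (m≤n⇒m≤1+n (countBelow-mono xs j≤k))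
  ... | no a≮j | no a≮k = subst₂ _≤_ (sym (countBelow-≥ xs (≮⇒≥ a≮j))) (sym (countBelow-≥ xs (≮⇒≥ a≮k))) (countBelow-mono xs j≤k)

  countBelow-strict : ∀ {a j k} xs → a ∈ xs → j ≤ a → a < k → countBelow j xs < countBelow k xs
  countBelow-strict (b ∷ xs) (here refl) j≤a a<k =
    subst₂ _<_ (sym (countBelow-≥ xs j≤a)) (sym (countBelow-< xs a<k)) (s≤s (countBelow-mono xs (<⇒≤ (≤-<-trans j≤a a<k))))
  countBelow-strict {a} {j} {k} (b ∷ xs) (there a∈) j≤a a<k with b <? j | b <? k
  ... | yes b<j | yes b<k = subst₂ _<_ (sym (countBelow-< xs b<j)) (sym (countBelow-< xs b<k)) (s≤s (countBelow-strict xs a∈ j≤a a<k))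
  ... | yes b<j | no b≮k = contradiction (<-trans b<j (≤-<-trans j≤a a<k)) b≮k
  ... | no b≮j | yes b<k = subst₂ _<_ (sym (countBelow-≥ xs (≮⇒≥ b≮j))) (sym (countBelow-< xs b<k)) (m≤n⇒m≤1+n (countBelow-strict xs a∈ j≤a a<k))
  ... | no b≮j | no b≮k = subst₂ _<_ (sym (countBelow-≥ xs (≮⇒≥ b≮j))) (sym (countBelow-≥ xs (≮⇒≥ b≮k))) (countBelow-strict xs a∈ j≤a a<k)

  countBelow<length : ∀ {a k} xs → a ∈ xs → k ≤ a → countBelow k xs < length xs
  countBelow<length xs a∈ k≤a = filter-notAll (_<? _) xs (Any.map (λ { refl → ≤⇒≯ k≤a }) a∈)

  countBelow>0⇒∃ : ∀ {k} xs → 0 < countBelow k xs → ∃[ a ] a ∈ xs × a < k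
  countBelow>0⇒∃ {k} xs pos with filter (_<? k) xs in eq
  ... | a ∷ _ = a , ∈-filter⁻ (_<? k) (subst (a ∈_) (sym eq) (here refl))

  countBelow<length⇒∃ : ∀ {k} xs → countBelow k xs < length xs → ∃[ a ] a ∈ xs × k ≤ a
  countBelow<length⇒∃ {k} xs lt with all? (_<? k) xs
  ... | yes all< = contradiction (countBelow-all all<) (<⇒≢ lt)
  ... | no ¬all< with find (¬All⇒Any¬ (_<? k) xs ¬all<)
  ...   | a , a∈ , a≮k = a , a∈ , ≮⇒≥ a≮k

countBelow-∷ʳ-< : ∀ {a k} xs → a < k → countBelow k (xs ∷ʳ a) ≡ suc (countBelow k xs)
countBelow-∷ʳ-< {a} {k} xs a<k = begin
  countBelow k (xs ∷ʳ a)              ≡⟨ countBelow-++ k xs [ a ] ⟩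
  countBelow k xs + countBelow k [ a ] ≡⟨ cong (countBelow k xs +_) (trans (countBelow-< [] a<k) (cong suc (countBelow-[] k))) ⟩
  countBelow k xs + 1                 ≡⟨ +-comm _ 1 ⟩
  suc (countBelow k xs)               ∎
  where open ≡-Reasoning

countBelow-∷ʳ-≥ : ∀ {a k} xs → k ≤ a → countBelow k (xs ∷ʳ a) ≡ countBelow k xs
countBelow-∷ʳ-≥ {a} {k} xs k≤a = begin
  countBelow k (xs ∷ʳ a)              ≡⟨ countBelow-++ k xs [ a ] ⟩
  countBelow k xs + countBelow k [ a ] ≡⟨ cong (countBelow k xs +_) (trans (countBelow-≥ [] k≤a) (countBelow-[] k)) ⟩
  countBelow k xs + 0                 ≡⟨ +-identityʳ _ ⟩
  countBelow k xs                     ∎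
  where open ≡-Reasoning

countBelow-∷ʳ-mono : ∀ k xs a → countBelow k xs ≤ countBelow k (xs ∷ʳ a)
countBelow-∷ʳ-mono k xs a = subst (countBelow k xs ≤_) (sym (countBelow-++ k xs [ a ])) (m≤m+n _ _)

countBelow-swap : ∀ k a b xs → countBelow k (a ∷ b ∷ xs) ≡ countBelow k (b ∷ a ∷ xs)
countBelow-swap k a b xs with a <? k | b <? k
... | yes a<k | yes b<k = begin
  countBelow k (a ∷ b ∷ xs) ≡⟨ countBelow-< (b ∷ xs) a<k ⟩
  suc (countBelow k (b ∷ xs)) ≡⟨ cong suc (countBelow-< xs b<k) ⟩
  suc (suc (countBelow k xs)) ≡⟨ cong suc (countBelow-< xs a<k) ⟨
  suc (countBelow k (a ∷ xs)) ≡⟨ countBelow-< (a ∷ xs) b<k ⟨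
  countBelow k (b ∷ a ∷ xs) ∎
  where open ≡-Reasoning
... | yes a<k | no b≮k = trans (countBelow-< (b ∷ xs) a<k) (trans (cong suc (countBelow-≥ xs (≮⇒≥ b≮k)))
                            (trans (sym (countBelow-< xs a<k)) (sym (countBelow-≥ (a ∷ xs) (≮⇒≥ b≮k)))))
... | no a≮k | yes b<k = trans (countBelow-≥ (b ∷ xs) (≮⇒≥ a≮k)) (trans (countBelow-< xs b<k)
                            (trans (cong suc (sym (countBelow-≥ xs (≮⇒≥ a≮k)))) (sym (countBelow-< (a ∷ xs) b<k))))
... | no a≮k | no b≮k = trans (countBelow-≥ (b ∷ xs) (≮⇒≥ a≮k)) (trans (countBelow-≥ xs (≮⇒≥ b≮k))
                            (trans (sym (countBelow-≥ xs (≮⇒≥ a≮k))) (sym (countBelow-≥ (a ∷ xs) (≮⇒≥ b≮k)))))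

countBelow-pos : ∀ {v k} xs → v ∈ xs → v < k → 0 < countBelow k xs
countBelow-pos {k = k} xs v∈ v<k = subst (_< countBelow k xs) (countBelow-zero xs) (countBelow-strict xs v∈ z≤n v<k)

countBelow-suc-∉ : ∀ {k} r → k ∉ r → countBelow (suc k) r ≡ countBelow k r
countBelow-suc-∉ [] _ = trans (countBelow-[] _) (sym (countBelow-[] _))
countBelow-suc-∉ {k} (a ∷ r) k∉ with <-cmp a k
... | tri< a<k _ _ = trans (countBelow-< r (m<n⇒m<1+n a<k))
  (trans (cong suc (countBelow-suc-∉ r (k∉ ∘ there))) (sym (countBelow-< r a<k)))
... | tri≈ _ refl _ = contradiction (here refl) k∉
... | tri> _ _ k<a = trans (countBelow-≥ r k<a) (trans (countBelow-suc-∉ r (k∉ ∘ there)) (sym (countBelow-≥ r (<⇒≤ k<a))))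

countBelow-suc-∈ : ∀ {k} r → AllPairs _≢_ r → k ∈ r → countBelow (suc k) r ≡ suc (countBelow k r)
countBelow-suc-∈ {k} (a ∷ r) (a∉r ∷ _) (here refl) = begin
  countBelow (suc a) (a ∷ r) ≡⟨ countBelow-< r ≤-refl ⟩
  suc (countBelow (suc a) r) ≡⟨ cong suc (countBelow-suc-∉ r (λ a∈r → All.lookup a∉r a∈r refl)) ⟩
  suc (countBelow a r)       ≡⟨ cong suc (countBelow-≥ r ≤-refl) ⟨
  suc (countBelow a (a ∷ r)) ∎
  where open ≡-Reasoning
countBelow-suc-∈ {k} (a ∷ r) (a∉r ∷ r!) (there k∈) with <-cmp a k
... | tri< a<k _ _ = trans (countBelow-< r (m<n⇒m<1+n a<k))
  (trans (cong suc (countBelow-suc-∈ r r! k∈)) (cong suc (sym (countBelow-< r a<k))))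
... | tri≈ _ refl _ = contradiction refl (All.lookup a∉r k∈)
... | tri> _ _ k<a = trans (countBelow-≥ r k<a) (trans (countBelow-suc-∈ r r! k∈) (cong suc (sym (countBelow-≥ r (<⇒≤ k<a)))))

module _ {A : Set} where

  length-∷ʳ : ∀ (xs : List A) x → length (xs ∷ʳ x) ≡ suc (length xs)
  length-∷ʳ xs x = trans (length-++ xs) (+-comm _ 1)

  ∈-∷ʳ⁻ : ∀ {v a} (xs : List A) → v ∈ xs ∷ʳ a → v ∈ xs ⊎ v ≡ a
  ∈-∷ʳ⁻ xs v∈ with ∈-++⁻ xs v∈
  ... | inj₁ v∈xs = inj₁ v∈xs
  ... | inj₂ (here v≡a) = inj₂ v≡a

  ∈-∷ʳ-last : ∀ {a} (xs : List A) → a ∈ xs ∷ʳ a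
  ∈-∷ʳ-last xs = ∈-++⁺ʳ xs (here refl)

  AllPairs-resp-⊆ : ∀ {R : A → A → Set} {xs ys} → xs ⊆ ys → AllPairs R ys → AllPairs R xs
  AllPairs-resp-⊆ [] [] = []
  AllPairs-resp-⊆ (skip y xs⊆ys) (_ ∷ ys!) = AllPairs-resp-⊆ xs⊆ys ys!
  AllPairs-resp-⊆ (refl ∷ xs⊆ys) (y≁ ∷ ys!) = All-resp-⊆ xs⊆ys y≁ ∷ AllPairs-resp-⊆ xs⊆ys ys!

  AllPairs-∷ʳ⁺ : ∀ {R : A → A → Set} {xs x} → AllPairs R xs → All (λ y → R y x) xs → AllPairs R (xs ∷ʳ x)
  AllPairs-∷ʳ⁺ xs! allR = AllPairsₚ.++⁺ xs! ([] ∷ []) (All.map (_∷ []) allR)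

  AllPairs-∷ʳ⁻ : ∀ {R : A → A → Set} xs {x} → AllPairs R (xs ∷ʳ x) → AllPairs R xs × All (λ y → R y x) xs
  AllPairs-∷ʳ⁻ [] _ = [] , []
  AllPairs-∷ʳ⁻ (y ∷ xs) (y≁ ∷ xs!) with AllPairs-∷ʳ⁻ xs xs! | ∷ʳ⁻ y≁
  ... | xs!′ , allR | y≁xs , yRx = (y≁xs ∷ xs!′) , (yRx ∷ allR)

  ⊆-∷ʳ-inv : ∀ {s : List A} xs {x} → s ⊆ xs ∷ʳ x → s ⊆ xs ⊎ ∃[ s′ ] s ≡ s′ ∷ʳ x × s′ ⊆ xs
  ⊆-∷ʳ-inv [] (skip _ []) = inj₁ []
  ⊆-∷ʳ-inv [] (refl ∷ []) = inj₂ ([] , refl , [])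
  ⊆-∷ʳ-inv (y ∷ xs) (skip .y s⊆) with ⊆-∷ʳ-inv xs s⊆
  ... | inj₁ s⊆xs = inj₁ (skip y s⊆xs)
  ... | inj₂ (s′ , refl , s′⊆xs) = inj₂ (s′ , refl , skip y s′⊆xs)
  ⊆-∷ʳ-inv (y ∷ xs) (refl ∷ s⊆) with ⊆-∷ʳ-inv xs s⊆
  ... | inj₁ s⊆xs = inj₁ (refl ∷ s⊆xs)
  ... | inj₂ (s′ , refl , s′⊆xs) = inj₂ (y ∷ s′ , refl , refl ∷ s′⊆xs)

  ⊆-∷ʳ⁻ : ∀ {s : List A} xs {x} → s ⊆ xs ∷ʳ x → x ∉ s → s ⊆ xs
  ⊆-∷ʳ⁻ xs s⊆ x∉s with ⊆-∷ʳ-inv xs s⊆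
  ... | inj₁ s⊆xs = s⊆xs
  ... | inj₂ (s′ , refl , _) = contradiction (∈-++⁺ʳ s′ (here refl)) x∉s

  ⊆-∷ʳ-head : ∀ {a b : A} {s} xs {x} → a ∷ b ∷ s ⊆ xs ∷ʳ x → a ∈ xs
  ⊆-∷ʳ-head [] (skip _ ())
  ⊆-∷ʳ-head [] (refl ∷ ())
  ⊆-∷ʳ-head (y ∷ xs) (skip .y s⊆) = there (⊆-∷ʳ-head xs s⊆)
  ⊆-∷ʳ-head (y ∷ xs) (refl ∷ s⊆) = here refl

  pair-⊆ : ∀ {a b} (xs : List A) → a ∈ xs → b ∈ xs → a ≢ b → a ∷ b ∷ [] ⊆ xs ⊎ b ∷ a ∷ [] ⊆ xs
  pair-⊆ (x ∷ xs) (here refl) (here refl) a≢b = contradiction refl a≢b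
  pair-⊆ (x ∷ xs) (here refl) (there b∈) a≢b = inj₁ (refl ∷ from∈ b∈)
  pair-⊆ (x ∷ xs) (there a∈) (here refl) a≢b = inj₂ (refl ∷ from∈ a∈)
  pair-⊆ (x ∷ xs) (there a∈) (there b∈) a≢b with pair-⊆ xs a∈ b∈ a≢b
  ... | inj₁ ab⊆ = inj₁ (skip x ab⊆)
  ... | inj₂ ba⊆ = inj₂ (skip x ba⊆)

  ⊆-map-inv : ∀ {B : Set} (f : A → B) {s} xs → s ⊆ map f xs → ∃[ s′ ] s′ ⊆ xs × map f s′ ≡ s
  ⊆-map-inv f [] [] = [] , [] , refl
  ⊆-map-inv f (x ∷ xs) (skip _ s⊆) with ⊆-map-inv f xs s⊆
  ... | s′ , s′⊆ , refl = s′ , skip x s′⊆ , refl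
  ⊆-map-inv f (x ∷ xs) (refl ∷ s⊆) with ⊆-map-inv f xs s⊆
  ... | s′ , s′⊆ , refl = x ∷ s′ , refl ∷ s′⊆ , refl

module _ {A : Set} {L M : List A} where

  ∈-mid⁻ : ∀ {x y} → y ∈ L ++ x ∷ M → y ≡ x ⊎ y ∈ L ++ M
  ∈-mid⁻ {x} y∈ with ∈-++⁻ L y∈
  ... | inj₁ y∈L = inj₂ (∈-++⁺ˡ y∈L)
  ... | inj₂ (here y≡x) = inj₁ y≡x
  ... | inj₂ (there y∈M) = inj₂ (∈-++⁺ʳ L y∈M)

  ∈-mid⁺ : ∀ {x y} → y ∈ L ++ M → y ∈ L ++ x ∷ M
  ∈-mid⁺ y∈ with ∈-++⁻ L y∈
  ... | inj₁ y∈L = ∈-++⁺ˡ y∈L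
  ... | inj₂ y∈M = ∈-++⁺ʳ L (there y∈M)

∈-sublists : ∀ {s xs} → s ⊆ xs → s ∈ sublists xs
∈-sublists [] = here refl
∈-sublists {xs = x ∷ xs} (skip _ s⊆) = ∈-++⁺ʳ (map (x ∷_) (sublists xs)) (∈-sublists s⊆)
∈-sublists (refl ∷ s⊆) = ∈-++⁺ˡ (∈-map⁺ (_ ∷_) (∈-sublists s⊆))

sublists-⊆ : ∀ {s} xs → s ∈ sublists xs → s ⊆ xs
sublists-⊆ [] (here refl) = []
sublists-⊆ (x ∷ xs) s∈ with ∈-++⁻ (map (x ∷_) (sublists xs)) s∈
... | inj₂ s∈′ = skip x (sublists-⊆ xs s∈′)
... | inj₁ s∈′ with ∈-map⁻ (x ∷_) s∈′
...   | s′ , s′∈ , refl = refl ∷ sublists-⊆ xs s′∈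

module _ {A : Set} {R : A → A → Set} where

  AllPairs-comparable : ∀ {C a b} → AllPairs R C → a ∈ C → b ∈ C → a ≡ b ⊎ R a b ⊎ R b a
  AllPairs-comparable (_ ∷ _) (here refl) (here refl) = inj₁ refl
  AllPairs-comparable (a≁ ∷ _) (here refl) (there b∈) = inj₂ (inj₁ (All.lookup a≁ b∈))
  AllPairs-comparable (b≁ ∷ _) (there a∈) (here refl) = inj₂ (inj₂ (All.lookup b≁ a∈))
  AllPairs-comparable (_ ∷ C!) (there a∈) (there b∈) = AllPairs-comparable C! a∈ b∈

  sortedSubset⇒sublist : (∀ {a b} → R a b → ¬ R b a) → ∀ {C S} → AllPairs R C → AllPairs R S → All (_∈ S) C → C ⊆ S
  sortedSubset⇒sublist asym {[]} {S} _ _ _ = minimum S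
  sortedSubset⇒sublist asym {c ∷ C} {s ∷ S} (c≁ ∷ C!) (s≁ ∷ S!) (here refl ∷ C∈) =
    refl ∷ sortedSubset⇒sublist asym C! S! (All.zipWith (λ (c<x , x∈) → in-tail c<x x∈) (c≁ , C∈))
    where
    in-tail : ∀ {x} → R c x → x ∈ c ∷ S → x ∈ S
    in-tail c<x (here refl) = contradiction c<x (asym c<x)
    in-tail c<x (there x∈) = x∈
  sortedSubset⇒sublist asym {c ∷ C} {s ∷ S} (c≁ ∷ C!) (s≁ ∷ S!) (there c∈ ∷ C∈) =
    skip s (sortedSubset⇒sublist asym (c≁ ∷ C!) S! (c∈ ∷ All.zipWith (λ (c<x , x∈) → in-tail c<x x∈) (c≁ , C∈)))
    where
    in-tail : ∀ {x} → R c x → x ∈ s ∷ S → x ∈ S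
    in-tail c<x (here refl) = contradiction (All.lookup s≁ c∈) (asym c<x)
    in-tail c<x (there x∈) = x∈

concatMap-AllPairs : ∀ {A B : Set} {S : A → A → Set} {R : B → B → Set} (g : A → List B) →
  (∀ x → AllPairs R (g x)) → (∀ {x y} → S x y → ∀ {p q} → p ∈ g x → q ∈ g y → R p q) →
  ∀ {xs} → AllPairs S xs → AllPairs R (concatMap g xs)
concatMap-AllPairs g g! cross xs! = AllPairsₚ.concat⁺ (Allₚ.map⁺ (All.universal g! _))
  (AllPairsₚ.map⁺ (AllPairs.map (λ Sxy → All.tabulate (λ p∈ → All.tabulate (λ q∈ → cross Sxy p∈ q∈))) xs!))

module _ {A B : Set} {P : B → Set} {Q : A → Set} (P? : Decidable P) (Q? : Decidable Q) (f : A → B)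
         (P∘f⇒Q : ∀ {x} → P (f x) → Q x) (Q⇒P∘f : ∀ {x} → Q x → P (f x)) where

  filter-map : ∀ xs → filter P? (map f xs) ≡ map f (filter Q? xs)
  filter-map [] = refl
  filter-map (x ∷ xs) with P? (f x) | Q? x
  ... | yes _ | yes _ = cong (f x ∷_) (filter-map xs)
  ... | yes p | no ¬q = contradiction (P∘f⇒Q p) ¬q
  ... | no ¬p | yes q = contradiction (Q⇒P∘f q) ¬p
  ... | no _ | no _ = filter-map xs

filter-≐-on : ∀ {A : Set} {P Q : A → Set} (P? : Decidable P) (Q? : Decidable Q) {xs} →
  All (λ x → (P x → Q x) × (Q x → P x)) xs → filter P? xs ≡ filter Q? xs
filter-≐-on P? Q? [] = refl
filter-≐-on P? Q? {x ∷ xs} ((P⇒Q , Q⇒P) ∷ rest) with P? x | Q? x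
... | yes _ | yes _ = cong (x ∷_) (filter-≐-on P? Q? rest)
... | yes p | no ¬q = contradiction (P⇒Q p) ¬q
... | no ¬p | yes q = contradiction (Q⇒P q) ¬p
... | no _ | no _ = filter-≐-on P? Q? rest

take-applyUpTo : ∀ {A : Set} (f : ℕ → A) {k n} → k ≤ n → take k (applyUpTo f n) ≡ applyUpTo f k
take-applyUpTo f {zero} _ = refl
take-applyUpTo f {suc k} {suc n} (s≤s k≤n) = cong (f 0 ∷_) (take-applyUpTo (f ∘ suc) k≤n)

tabulate-toℕ : ∀ {A : Set} n (f : ℕ → A) → tabulate (f ∘ toℕ {n}) ≡ applyUpTo f n
tabulate-toℕ zero f = refl
tabulate-toℕ (suc n) f = cong (f 0 ∷_) (tabulate-toℕ n (f ∘ suc))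

tabulate-split : ∀ {A : Set} {n} (f : Fin n → A) (i : Fin n) → ∃[ P ] ∃[ S ]
  tabulate f ≡ P ++ f i ∷ S × length P ≡ toℕ i × (∀ j → j F.< i → f j ∈ P) × (∀ j → i F.< j → f j ∈ S)
tabulate-split {n = suc n} f F.zero = [] , tabulate (f ∘ F.suc) , refl , refl , (λ _ ()) , λ { (F.suc j) _ → ∈-tabulate⁺ j }
tabulate-split {n = suc n} f (F.suc i) with tabulate-split (f ∘ F.suc) i
... | P , S , split , |P| , before , after = f F.zero ∷ P , S , cong (f F.zero ∷_) split , cong suc |P| , before′ , after′
  where
  before′ : ∀ j → j F.< F.suc i → f j ∈ f F.zero ∷ P
  before′ F.zero _ = here refl
  before′ (F.suc j) j<i = there (before j (s≤s⁻¹ j<i))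
  after′ : ∀ j → F.suc i F.< j → f j ∈ S
  after′ (F.suc j) i<j = after j (s≤s⁻¹ i<j)

-- Longest increasing subsequences

record MaxLength {A : Set} (P : List A → Set) (m : ℕ) : Set where
  field
    witness : List A
    witness-satisfies : P witness
    witness-length : length witness ≡ m
    bounded : ∀ {s} → P s → length s ≤ m

MaxLength-transfer : ∀ {A B : Set} {P : List A → Set} {Q : List B → Set} {m} →
  (∀ {s} → P s → ∃[ t ] Q t × length t ≡ length s) →
  (∀ {t} → Q t → ∃[ s ] P s × length s ≡ length t) →
  MaxLength P m → MaxLength Q m
MaxLength-transfer P⇒Q Q⇒P M = record
  { witness = proj₁ (P⇒Q witness-satisfies)
  ; witness-satisfies = proj₁ (proj₂ (P⇒Q witness-satisfies))
  ; witness-length = trans (proj₂ (proj₂ (P⇒Q witness-satisfies))) witness-length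
  ; bounded = λ Qt → let (s , Ps , len) = Q⇒P Qt in subst (_≤ _) len (bounded Ps) }
  where open MaxLength M

IncreasingSublist : List ℕ → List ℕ → Set
IncreasingSublist ws s = s ⊆ ws × AllPairs _<_ s

increasing⇒AllPairs : ∀ s → T (increasing s) → AllPairs _<_ s
increasing⇒AllPairs [] _ = []
increasing⇒AllPairs (x ∷ []) _ = [] ∷ []
increasing⇒AllPairs (x ∷ y ∷ s) t =
  prepend (<ᵇ⇒< x y (proj₁ x<y∧inc)) (increasing⇒AllPairs (y ∷ s) (proj₂ x<y∧inc))
  where
  x<y∧inc : T (x <ᵇ y) × T (increasing (y ∷ s))
  x<y∧inc = Equivalence.to (T-∧ {x <ᵇ y}) t
  prepend : x < y → AllPairs _<_ (y ∷ s) → AllPairs _<_ (x ∷ y ∷ s)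
  prepend x<y ys!@(y<s ∷ _) = (x<y ∷ All.map (<-trans x<y) y<s) ∷ ys!

AllPairs⇒increasing : ∀ s → AllPairs _<_ s → T (increasing s)
AllPairs⇒increasing [] _ = tt
AllPairs⇒increasing (x ∷ []) _ = tt
AllPairs⇒increasing (x ∷ y ∷ s) ((x<y ∷ _) ∷ ys!) rewrite <ᵇ-true x<y = AllPairs⇒increasing (y ∷ s) ys!

maximum-upper : ∀ {x} xs → x ∈ xs → x ≤ maximum xs
maximum-upper (a ∷ xs) (here refl) = m≤m⊔n a (maximum xs)
maximum-upper (a ∷ xs) (there x∈) = ≤-trans (maximum-upper xs x∈) (m≤n⊔m a (maximum xs))

maximum-least : ∀ {b} xs → (∀ {x} → x ∈ xs → x ≤ b) → maximum xs ≤ b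
maximum-least [] _ = z≤n
maximum-least (a ∷ xs) ≤b = ⊔-lub (≤b (here refl)) (maximum-least xs (≤b ∘ there))

lis-MaxLength : ∀ {n} (σ : Permutation′ n) {m} → MaxLength (IncreasingSublist (oneLine σ)) m → lis σ ≡ m
lis-MaxLength σ {m} M = ≤-antisym (maximum-least _ upper) (subst (_≤ lis σ) witness-length (maximum-upper _ attained))
  where
  open MaxLength M
  isIncreasing : Decidable (T ∘ increasing)
  isIncreasing s = Bool.T? (increasing s)
  attained : length witness ∈ map length (filter isIncreasing (sublists (oneLine σ)))
  attained = ∈-map⁺ length (∈-filter⁺ isIncreasing (∈-sublists (proj₁ witness-satisfies)) (AllPairs⇒increasing witness (proj₂ witness-satisfies)))
  upper : ∀ {x} → x ∈ map length (filter isIncreasing (sublists (oneLine σ))) → x ≤ m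
  upper x∈ with ∈-map⁻ length x∈
  ... | s , s∈ , refl with ∈-filter⁻ isIncreasing {xs = sublists (oneLine σ)} s∈
  ...   | s∈′ , inc = bounded (sublists-⊆ (oneLine σ) s∈′ , increasing⇒AllPairs s inc)

IncreasingBelow : ℕ → List ℕ → List ℕ → Set
IncreasingBelow v ws s = IncreasingSublist ws s × All (_< v) s

module _ {ws : List ℕ} {x : ℕ} where

  increasingBelow-∷ʳ-inv : ∀ {v s} → IncreasingBelow v (ws ∷ʳ x) s →
    IncreasingBelow v ws s ⊎ ∃[ s′ ] s ≡ s′ ∷ʳ x × IncreasingBelow x ws s′ × x < v
  increasingBelow-∷ʳ-inv ((s⊆ , s<) , s<v) with ⊆-∷ʳ-inv ws s⊆
  ... | inj₁ s⊆ws = inj₁ ((s⊆ws , s<) , s<v)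
  ... | inj₂ (s′ , refl , s′⊆ws) =
    let (s′< , s′<x) = AllPairs-∷ʳ⁻ s′ s< in inj₂ (s′ , refl , ((s′⊆ws , s′<) , s′<x) , proj₂ (∷ʳ⁻ s<v))

  increasingBelow-∷ʳ : ∀ {v s} → IncreasingBelow v ws s → IncreasingBelow v (ws ∷ʳ x) s
  increasingBelow-∷ʳ ((s⊆ , s<) , s<v) = (++⁺ʳ [ x ] s⊆ , s<) , s<v

  longestBelow-∷ʳ-≥ : ∀ {v m} → v ≤ x → MaxLength (IncreasingBelow v ws) m → MaxLength (IncreasingBelow v (ws ∷ʳ x)) m
  longestBelow-∷ʳ-≥ v≤x M = record
    { witness = witness
    ; witness-satisfies = increasingBelow-∷ʳ witness-satisfies
    ; witness-length = witness-length
    ; bounded = λ s-ok → [ bounded , (λ { (_ , _ , _ , x<v) → contradiction v≤x (<⇒≱ x<v) }) ]′ (increasingBelow-∷ʳ-inv s-ok) }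
    where open MaxLength M

  longestBelow-∷ʳ-< : ∀ {v k m} → x < v → MaxLength (IncreasingBelow x ws) k → MaxLength (IncreasingBelow v ws) m →
    MaxLength (IncreasingBelow v (ws ∷ʳ x)) (m ⊔ suc k)
  longestBelow-∷ʳ-< {v} {k} {m} x<v Mx Mv = record
    { witness = proj₁ best
    ; witness-satisfies = proj₁ (proj₂ best)
    ; witness-length = proj₂ (proj₂ best)
    ; bounded = bounded }
    where
    module Mx = MaxLength Mx
    module Mv = MaxLength Mv
    extended : IncreasingBelow v (ws ∷ʳ x) (Mx.witness ∷ʳ x)
    extended = let ((s⊆ , s<) , s<x) = Mx.witness-satisfies in
      (++⁺ s⊆ (refl ∷ []) , AllPairs-∷ʳ⁺ s< s<x) , ∷ʳ⁺ (All.map (λ y<x → <-trans y<x x<v) s<x) x<v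
    best : ∃[ s ] IncreasingBelow v (ws ∷ʳ x) s × length s ≡ m ⊔ suc k
    best with ≤-total (suc k) m
    ... | inj₁ 1+k≤m = Mv.witness , increasingBelow-∷ʳ Mv.witness-satisfies , trans Mv.witness-length (sym (m≥n⇒m⊔n≡m 1+k≤m))
    ... | inj₂ m≤1+k = Mx.witness ∷ʳ x , extended , (begin
      length (Mx.witness ∷ʳ x) ≡⟨ length-∷ʳ Mx.witness x ⟩
      suc (length Mx.witness)  ≡⟨ cong suc Mx.witness-length ⟩
      suc k                    ≡⟨ m≤n⇒m⊔n≡n m≤1+k ⟨
      m ⊔ suc k                ∎)
      where open ≡-Reasoning
    bounded : ∀ {s} → IncreasingBelow v (ws ∷ʳ x) s → length s ≤ m ⊔ suc k
    bounded s-ok with increasingBelow-∷ʳ-inv s-ok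
    ... | inj₁ s-ok′ = ≤-trans (Mv.bounded s-ok′) (m≤m⊔n m (suc k))
    ... | inj₂ (s′ , refl , s′-ok , _) = begin
      length (s′ ∷ʳ x) ≡⟨ length-∷ʳ s′ x ⟩
      suc (length s′)  ≤⟨ s≤s (Mx.bounded s′-ok) ⟩
      suc k            ≤⟨ m≤n⊔m m (suc k) ⟩
      m ⊔ suc k        ∎
      where open ≤-Reasoning

-- Row insertion into a two-row tableau

twoRow : List ℕ → List ℕ → Tableau
twoRow r₁ [] = r₁ ∷ []
twoRow r₁ r₂@(_ ∷ _) = r₁ ∷ r₂ ∷ []

insertRow-all< : ∀ {x} r → All (_< x) r → insertRow x r ≡ (nothing , r ∷ʳ x)
insertRow-all< [] [] = refl
insertRow-all< {x} (a ∷ r) (a<x ∷ r<x) rewrite <ᵇ-false {x} {a} (<⇒≤ a<x) | insertRow-all< r r<x = refl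

insertT-append : ∀ {x r₁ r₁′} r₂ → insertRow x r₁ ≡ (nothing , r₁′) → insertT x (twoRow r₁ r₂) ≡ (twoRow r₁′ r₂ , 0)
insertT-append [] eq rewrite eq = refl
insertT-append (_ ∷ _) eq rewrite eq = refl

insertT-bump : ∀ {x y r₁ r₁′} r₂ → insertRow x r₁ ≡ (just y , r₁′) → All (_< y) r₂ →
  insertT x (twoRow r₁ r₂) ≡ (twoRow r₁′ (r₂ ∷ʳ y) , 1)
insertT-bump [] eq _ rewrite eq = refl
insertT-bump (a ∷ r₂) eq r₂<y rewrite eq | insertRow-all< (a ∷ r₂) r₂<y = refl

addAt-row₁ : ∀ t q₁ q₂ → addAt t 0 (twoRow q₁ q₂) ≡ twoRow (q₁ ∷ʳ t) q₂
addAt-row₁ t q₁ [] = refl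
addAt-row₁ t q₁ (_ ∷ _) = refl

addAt-row₂ : ∀ t q₁ q₂ → addAt t 1 (twoRow q₁ q₂) ≡ twoRow q₁ (q₂ ∷ʳ t)
addAt-row₂ t q₁ [] = refl
addAt-row₂ t q₁ (_ ∷ _) = refl

rowLength-twoRow : ∀ r₁ r₂ → rowLength 1 (twoRow r₁ r₂) ≡ length r₂
rowLength-twoRow r₁ [] = refl
rowLength-twoRow r₁ (_ ∷ _) = refl

firstRow-twoRow : ∀ r₁ r₂ → firstRow (twoRow r₁ r₂) ≡ r₁
firstRow-twoRow r₁ [] = refl
firstRow-twoRow r₁ (_ ∷ _) = refl

insertedRow : ℕ → List ℕ → List ℕ
insertedRow x r = proj₂ (insertRow x r)

insertedRow-< : ∀ {x a} r → x < a → insertedRow x (a ∷ r) ≡ x ∷ r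
insertedRow-< r x<a rewrite <ᵇ-true x<a = refl

insertedRow-≥ : ∀ {x a} r → a ≤ x → insertedRow x (a ∷ r) ≡ a ∷ insertedRow x r
insertedRow-≥ r a≤x rewrite <ᵇ-false a≤x = refl

countBelow-insertedRow-≥ : ∀ {x v} r → v ≤ x → countBelow v (insertedRow x r) ≡ countBelow v r
countBelow-insertedRow-≥ [] v≤x = countBelow-≥ [] v≤x
countBelow-insertedRow-≥ {x} {v} (a ∷ r) v≤x with x <? a
... | yes x<a = begin
  countBelow v (insertedRow x (a ∷ r)) ≡⟨ cong (countBelow v) (insertedRow-< r x<a) ⟩
  countBelow v (x ∷ r)                 ≡⟨ countBelow-≥ r v≤x ⟩
  countBelow v r                       ≡⟨ countBelow-≥ r (≤-trans v≤x (<⇒≤ x<a)) ⟨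
  countBelow v (a ∷ r)                 ∎
  where open ≡-Reasoning
... | no x≮a = begin
  countBelow v (insertedRow x (a ∷ r)) ≡⟨ cong (countBelow v) (insertedRow-≥ r (≮⇒≥ x≮a)) ⟩
  countBelow v (a ∷ insertedRow x r)   ≡⟨ countBelow-∷-cong a (countBelow-insertedRow-≥ r v≤x) ⟩
  countBelow v (a ∷ r)                 ∎
  where open ≡-Reasoning

countBelow-insertedRow-< : ∀ {x v} r → AllPairs _<_ r → x ∉ r → x < v →
  countBelow v (insertedRow x r) ≡ countBelow v r ⊔ suc (countBelow x r)
countBelow-insertedRow-< {x} {v} [] [] _ x<v rewrite countBelow-[] v | countBelow-[] x = trans (countBelow-< [] x<v) (cong suc (countBelow-[] v))
countBelow-insertedRow-< {x} {v} (a ∷ r) (a<r ∷ r!) x∉ x<v with x <? a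
... | yes x<a = begin
  countBelow v (insertedRow x (a ∷ r))          ≡⟨ cong (countBelow v) (insertedRow-< r x<a) ⟩
  countBelow v (x ∷ r)                          ≡⟨ countBelow-< r x<v ⟩
  suc (countBelow v r)                          ≡⟨ bumped-count ⟩
  countBelow v (a ∷ r) ⊔ 1                      ≡⟨ cong (λ c → countBelow v (a ∷ r) ⊔ suc c) nothing-below-x ⟨
  countBelow v (a ∷ r) ⊔ suc (countBelow x (a ∷ r)) ∎
  where
  open ≡-Reasoning
  nothing-below-x : countBelow x (a ∷ r) ≡ 0
  nothing-below-x = countBelow-none (<⇒≤ x<a ∷ All.map (λ a<b → <⇒≤ (<-trans x<a a<b)) a<r)
  bumped-count : suc (countBelow v r) ≡ countBelow v (a ∷ r) ⊔ 1
  bumped-count with a <? v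
  ... | yes a<v = trans (cong suc (sym (⊔-identityʳ _))) (cong (_⊔ 1) (sym (countBelow-< r a<v)))
  ... | no a≮v = begin
    suc (countBelow v r)     ≡⟨ cong suc nothing-below-v ⟩
    1                        ≡⟨ cong (_⊔ 1) (trans (countBelow-≥ r (≮⇒≥ a≮v)) nothing-below-v) ⟨
    countBelow v (a ∷ r) ⊔ 1 ∎
    where
    nothing-below-v : countBelow v r ≡ 0
    nothing-below-v = countBelow-none (All.map (λ a<b → <⇒≤ (≤-<-trans (≮⇒≥ a≮v) a<b)) a<r)
... | no x≮a = begin
  countBelow v (insertedRow x (a ∷ r))              ≡⟨ cong (countBelow v) (insertedRow-≥ r (≮⇒≥ x≮a)) ⟩
  countBelow v (a ∷ insertedRow x r)                ≡⟨ countBelow-< (insertedRow x r) a<v ⟩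
  suc (countBelow v (insertedRow x r))              ≡⟨ cong suc (countBelow-insertedRow-< r r! (x∉ ∘ there) x<v) ⟩
  suc (countBelow v r) ⊔ suc (suc (countBelow x r)) ≡⟨ cong₂ (λ c c′ → c ⊔ suc c′) (countBelow-< r a<v) (countBelow-< r a<x) ⟨
  countBelow v (a ∷ r) ⊔ suc (countBelow x (a ∷ r)) ∎
  where
  open ≡-Reasoning
  a<x : a < x
  a<x = ≤∧≢⇒< (≮⇒≥ x≮a) (λ a≡x → x∉ (here (sym a≡x)))
  a<v : a < v
  a<v = <-trans a<x x<v

countBelow-insertedRow-mono : ∀ {x k} r → AllPairs _<_ r → x ∉ r → countBelow k r ≤ countBelow k (insertedRow x r)
countBelow-insertedRow-mono {x} {k} r r! x∉ with k ≤? x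
... | yes k≤x = ≤-reflexive (sym (countBelow-insertedRow-≥ r k≤x))
... | no k≰x = ≤-trans (m≤m⊔n _ _) (≤-reflexive (sym (countBelow-insertedRow-< r r! x∉ (≰⇒> k≰x))))

record Bump (x : ℕ) (r : List ℕ) : Set where
  field
    bumped : ℕ
    insertRow≡ : insertRow x r ≡ (just bumped , insertedRow x r)
    bumped∈ : bumped ∈ r
    x<bumped : x < bumped
    bumped-least : ∀ {v} → v ∈ r → x < v → bumped ≤ v
    sorted : AllPairs _<_ (insertedRow x r)
    countBelow-exchange : ∀ k → countBelow k (bumped ∷ insertedRow x r) ≡ countBelow k (x ∷ r)
    ∈-insertedRow : ∀ {v} → v ∈ insertedRow x r → v ≡ x ⊎ (v ∈ r × v ≢ bumped)
    length-insertedRow : length (insertedRow x r) ≡ length r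

data RowInsertion (x : ℕ) (r : List ℕ) : Set where
  appends : All (_< x) r → RowInsertion x r
  bumps : Bump x r → RowInsertion x r

bump-head : ∀ {x a} r → All (a <_) r → AllPairs _<_ r → x < a → Bump x (a ∷ r)
bump-head {x} {a} r a<r r! x<a = record
  { bumped = a
  ; insertRow≡ = insertRow≡
  ; bumped∈ = here refl
  ; x<bumped = x<a
  ; bumped-least = λ { (here refl) _ → ≤-refl ; (there v∈) _ → <⇒≤ (All.lookup a<r v∈) }
  ; sorted = subst (AllPairs _<_) (sym (insertedRow-< r x<a)) (All.map (<-trans x<a) a<r ∷ r!)
  ; countBelow-exchange = λ k → subst (λ row → countBelow k (a ∷ row) ≡ countBelow k (x ∷ a ∷ r)) (sym (insertedRow-< r x<a)) (countBelow-swap k a x r)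
  ; ∈-insertedRow = λ v∈ → ∈-x∷r (subst (_ ∈_) (insertedRow-< r x<a) v∈)
  ; length-insertedRow = cong length (insertedRow-< r x<a) }
  where
  insertRow≡ : insertRow x (a ∷ r) ≡ (just a , insertedRow x (a ∷ r))
  insertRow≡ rewrite <ᵇ-true x<a = refl
  ∈-x∷r : ∀ {v} → v ∈ x ∷ r → v ≡ x ⊎ (v ∈ a ∷ r × v ≢ a)
  ∈-x∷r (here refl) = inj₁ refl
  ∈-x∷r (there v∈) = inj₂ (there v∈ , λ { refl → <-irrefl refl (All.lookup a<r v∈) })

bump-tail : ∀ {x a} r → All (a <_) r → a < x → Bump x r → Bump x (a ∷ r)
bump-tail {x} {a} r a<r a<x b = record
  { bumped = bumped
  ; insertRow≡ = insertRow≡′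
  ; bumped∈ = there bumped∈
  ; x<bumped = x<bumped
  ; bumped-least = λ { (here refl) x<a → contradiction x<a (<-asym a<x) ; (there v∈) x<v → bumped-least v∈ x<v }
  ; sorted = subst (AllPairs _<_) (sym (insertedRow-≥ r (<⇒≤ a<x))) (All.tabulate a<inserted ∷ sorted)
  ; countBelow-exchange = λ k → subst (λ row → countBelow k (bumped ∷ row) ≡ countBelow k (x ∷ a ∷ r)) (sym (insertedRow-≥ r (<⇒≤ a<x)))
      (trans (countBelow-swap k bumped a _) (trans (countBelow-∷-cong a (countBelow-exchange k)) (countBelow-swap k a x r)))
  ; ∈-insertedRow = λ v∈ → ∈-a∷inserted (subst (_ ∈_) (insertedRow-≥ r (<⇒≤ a<x)) v∈)
  ; length-insertedRow = trans (cong length (insertedRow-≥ r (<⇒≤ a<x))) (cong suc length-insertedRow) }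
  where
  open Bump b
  insertRow≡′ : insertRow x (a ∷ r) ≡ (just bumped , insertedRow x (a ∷ r))
  insertRow≡′ rewrite <ᵇ-false (<⇒≤ a<x) | insertRow≡ = refl
  a<inserted : ∀ {v} → v ∈ insertedRow x r → a < v
  a<inserted v∈ = [ (λ { refl → a<x }) , (λ (v∈r , _) → All.lookup a<r v∈r) ]′ (∈-insertedRow v∈)
  ∈-a∷inserted : ∀ {v} → v ∈ a ∷ insertedRow x r → v ≡ x ⊎ (v ∈ a ∷ r × v ≢ bumped)
  ∈-a∷inserted (here refl) = inj₂ (here refl , λ { refl → <-asym a<x x<bumped })
  ∈-a∷inserted (there v∈) = Sum.map id (λ (v∈r , v≢) → there v∈r , v≢) (∈-insertedRow v∈)

rowInsertion : ∀ x r → AllPairs _<_ r → x ∉ r → RowInsertion x r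
rowInsertion x [] [] x∉ = appends []
rowInsertion x (a ∷ r) (a<r ∷ r!) x∉ with x <? a
... | yes x<a = bumps (bump-head r a<r r! x<a)
... | no x≮a with a<x ← ≤∧≢⇒< (≮⇒≥ x≮a) (λ a≡x → x∉ (here (sym a≡x))) | rowInsertion x r r! (x∉ ∘ there)
...   | appends r<x = appends (a<x ∷ r<x)
...   | bumps b = bumps (bump-tail r a<r a<x b)

-- Robinson–Schensted on words avoiding 321

record RecordingInv (t : ℕ) (q₁ q₂ : List ℕ) : Set where
  field
    sorted₁ : AllPairs _<_ q₁
    entries₁< : All (_< t) q₁
    entries₂< : All (_< t) q₂
    partition : ∀ k → k ≤ t → countBelow k q₁ + countBelow k q₂ ≡ k
    ballot : ∀ k → countBelow k q₂ ≤ countBelow k q₁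

  length-rows : length q₁ + length q₂ ≡ t
  length-rows = trans (cong₂ _+_ (sym (countBelow-all entries₁<)) (sym (countBelow-all entries₂<))) (partition t ≤-refl)

  countBelow-beyond₁ : ∀ {k} → t ≤ k → countBelow k q₁ ≡ length q₁
  countBelow-beyond₁ t≤k = countBelow-all (All.map (λ v<t → <-≤-trans v<t t≤k) entries₁<)

  countBelow-beyond₂ : ∀ {k} → t ≤ k → countBelow k q₂ ≡ length q₂
  countBelow-beyond₂ t≤k = countBelow-all (All.map (λ v<t → <-≤-trans v<t t≤k) entries₂<)

recordingInv-empty : RecordingInv 0 [] []
recordingInv-empty = record
  { sorted₁ = [] ; entries₁< = [] ; entries₂< = []
  ; partition = λ { zero _ → cong₂ _+_ (countBelow-[] 0) (countBelow-[] 0) }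
  ; ballot = λ _ → ≤-refl }

module _ {t q₁ q₂} (R : RecordingInv t q₁ q₂) where
  open RecordingInv R

  private
    ∷ʳ-entries< : ∀ {q} → All (_< t) q → All (_< suc t) (q ∷ʳ t)
    ∷ʳ-entries< q<t = ∷ʳ⁺ (All.map m<n⇒m<1+n q<t) ≤-refl

    partition-new : ∀ {qa qb} → length qa + length qb ≡ suc t → All (_< suc t) qa → All (_< suc t) qb →
      (∀ k → k ≤ t → countBelow k qa + countBelow k qb ≡ k) → ∀ k → k ≤ suc t → countBelow k qa + countBelow k qb ≡ k
    partition-new len qa< qb< old k k≤1+t with k ≤? t
    ... | yes k≤t = old k k≤t
    ... | no k≰t rewrite ≤-antisym k≤1+t (≰⇒> k≰t) = trans (cong₂ _+_ (countBelow-all qa<) (countBelow-all qb<)) len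

  recordRow₁ : RecordingInv (suc t) (q₁ ∷ʳ t) q₂
  recordRow₁ = record
    { sorted₁ = AllPairs-∷ʳ⁺ sorted₁ entries₁<
    ; entries₁< = ∷ʳ-entries< entries₁<
    ; entries₂< = All.map m<n⇒m<1+n entries₂<
    ; partition = partition-new (trans (cong (_+ length q₂) (length-∷ʳ q₁ t)) (cong suc length-rows))
        (∷ʳ-entries< entries₁<) (All.map m<n⇒m<1+n entries₂<)
        (λ k k≤t → trans (cong (_+ countBelow k q₂) (countBelow-∷ʳ-≥ q₁ k≤t)) (partition k k≤t))
    ; ballot = λ k → ≤-trans (ballot k) (countBelow-∷ʳ-mono k q₁ t) }

  recordRow₂ : length q₂ < length q₁ → RecordingInv (suc t) q₁ (q₂ ∷ʳ t)
  recordRow₂ q₂<q₁ = record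
    { sorted₁ = sorted₁
    ; entries₁< = All.map m<n⇒m<1+n entries₁<
    ; entries₂< = ∷ʳ-entries< entries₂<
    ; partition = partition-new (trans (cong (length q₁ +_) (length-∷ʳ q₂ t)) (trans (+-suc _ _) (cong suc length-rows)))
        (All.map m<n⇒m<1+n entries₁<) (∷ʳ-entries< entries₂<)
        (λ k k≤t → trans (cong (countBelow k q₁ +_) (countBelow-∷ʳ-≥ q₂ k≤t)) (partition k k≤t))
    ; ballot = ballot′ }
    where
    ballot′ : ∀ k → countBelow k (q₂ ∷ʳ t) ≤ countBelow k q₁
    ballot′ k with t <? k
    ... | no t≮k = subst (_≤ countBelow k q₁) (sym (countBelow-∷ʳ-≥ q₂ (≮⇒≥ t≮k))) (ballot k)
    ... | yes t<k = begin
      countBelow k (q₂ ∷ʳ t) ≡⟨ countBelow-∷ʳ-< q₂ t<k ⟩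
      suc (countBelow k q₂)  ≡⟨ cong suc (countBelow-beyond₂ (<⇒≤ t<k)) ⟩
      suc (length q₂)        ≤⟨ q₂<q₁ ⟩
      length q₁              ≡⟨ countBelow-beyond₁ (<⇒≤ t<k) ⟨
      countBelow k q₁        ∎
      where open ≤-Reasoning

Avoids321List : List ℕ → Set
Avoids321List ws = ∀ {a b c} → a ∷ b ∷ c ∷ [] ⊆ ws → b < a → c < b → ⊥

record RowsInv (pre r₁ r₂ : List ℕ) : Set where
  field
    sorted₁ : AllPairs _<_ r₁
    row₁⊆ : ∀ {v} → v ∈ r₁ → v ∈ pre
    row₂⊆ : ∀ {v} → v ∈ r₂ → v ∈ pre
    disjoint : ∀ {v} → v ∈ r₁ → v ∉ r₂
    countBelow-rows : ∀ k → countBelow k r₁ + countBelow k r₂ ≡ countBelow k pre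
    length-rows : length r₁ + length r₂ ≡ length pre
    schensted : ∀ v → MaxLength (IncreasingBelow v pre) (countBelow v r₁)
    ballot : ∀ k → countBelow k r₂ ≤ countBelow k r₁
    -- With 321-avoidance this forces every letter bumped from row 1 to exceed all of row 2.
    between-after : ∀ {y z} → y ∈ r₁ → z ∈ r₂ → y < z → y ∷ z ∷ [] ⊆ pre →
      ∃[ x ] z ∷ x ∷ [] ⊆ pre × y < x × x < z

rowsInv-empty : RowsInv [] [] []
rowsInv-empty = record
  { sorted₁ = [] ; row₁⊆ = λ () ; row₂⊆ = λ () ; disjoint = λ ()
  ; countBelow-rows = λ k → cong (_+ countBelow k []) (countBelow-[] k)
  ; length-rows = refl
  ; schensted = λ v → record
    { witness = [] ; witness-satisfies = ([] , []) , [] ; witness-length = sym (countBelow-[] v)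
    ; bounded = λ { (([] , _) , _) → z≤n } }
  ; ballot = λ k → ≤-refl
  ; between-after = λ () }

-- Schensted's argument: the longest increasing subsequence below v and the part of
-- row 1 below v obey the same recursion when a letter is appended.
schensted-step : ∀ {pre r x} → AllPairs _<_ r → x ∉ r → (∀ v → MaxLength (IncreasingBelow v pre) (countBelow v r)) →
  ∀ v → MaxLength (IncreasingBelow v (pre ∷ʳ x)) (countBelow v (insertedRow x r))
schensted-step {pre} {r} {x} r! x∉ longest v with v ≤? x
... | yes v≤x = subst (MaxLength _) (sym (countBelow-insertedRow-≥ r v≤x)) (longestBelow-∷ʳ-≥ v≤x (longest v))
... | no v≰x = subst (MaxLength _) (sym (countBelow-insertedRow-< r r! x∉ (≰⇒> v≰x))) (longestBelow-∷ʳ-< (≰⇒> v≰x) (longest x) (longest v))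

module _ {pre r₁ r₂ x} (I : RowsInv pre r₁ r₂) (x∉pre : x ∉ pre) where
  open RowsInv I

  private
    pair-before-x : ∀ {y z} → y ∷ z ∷ [] ⊆ pre ∷ʳ x → z ∈ pre → y ∷ z ∷ [] ⊆ pre
    pair-before-x yz⊆ z∈ = ⊆-∷ʳ⁻ pre yz⊆ λ
      { (here refl) → x∉pre (⊆-∷ʳ-head pre yz⊆)
      ; (there (here refl)) → x∉pre z∈ }

    lift-between : ∀ {y z} → ∃[ x′ ] z ∷ x′ ∷ [] ⊆ pre × y < x′ × x′ < z → ∃[ x′ ] z ∷ x′ ∷ [] ⊆ pre ∷ʳ x × y < x′ × x′ < z
    lift-between (x′ , zx′⊆ , y<x′ , x′<z) = x′ , ++⁺ʳ [ x ] zx′⊆ , y<x′ , x′<z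

  module _ (r₁<x : All (_< x) r₁) where

    private
      countBelow-rows-append : ∀ k → countBelow k (r₁ ∷ʳ x) + countBelow k r₂ ≡ countBelow k (pre ∷ʳ x)
      countBelow-rows-append k = begin
        countBelow k (r₁ ∷ʳ x) + countBelow k r₂              ≡⟨ cong (_+ countBelow k r₂) (countBelow-++ k r₁ [ x ]) ⟩
        countBelow k r₁ + countBelow k [ x ] + countBelow k r₂ ≡⟨ xy∙z≈xz∙y (countBelow k r₁) (countBelow k [ x ]) (countBelow k r₂) ⟩
        countBelow k r₁ + countBelow k r₂ + countBelow k [ x ] ≡⟨ cong (_+ countBelow k [ x ]) (countBelow-rows k) ⟩
        countBelow k pre + countBelow k [ x ]                 ≡⟨ countBelow-++ k pre [ x ] ⟨
        countBelow k (pre ∷ʳ x)                               ∎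
        where open ≡-Reasoning

      between-after-append : ∀ {y z} → y ∈ r₁ ∷ʳ x → z ∈ r₂ → y < z → y ∷ z ∷ [] ⊆ pre ∷ʳ x →
        ∃[ x′ ] z ∷ x′ ∷ [] ⊆ pre ∷ʳ x × y < x′ × x′ < z
      between-after-append y∈ z∈ y<z yz⊆ with ∈-∷ʳ⁻ r₁ y∈
      ... | inj₂ refl = contradiction (⊆-∷ʳ-head pre yz⊆) x∉pre
      ... | inj₁ y∈r₁ = lift-between (between-after y∈r₁ z∈ y<z (pair-before-x yz⊆ (row₂⊆ z∈)))

    rowsInv-append : RowsInv (pre ∷ʳ x) (r₁ ∷ʳ x) r₂
    rowsInv-append = record
      { sorted₁ = AllPairs-∷ʳ⁺ sorted₁ r₁<x
      ; row₁⊆ = λ v∈ → [ ∈-++⁺ˡ ∘ row₁⊆ , (λ { refl → ∈-∷ʳ-last pre }) ]′ (∈-∷ʳ⁻ r₁ v∈)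
      ; row₂⊆ = ∈-++⁺ˡ ∘ row₂⊆
      ; disjoint = λ v∈ v∈r₂ → [ (λ v∈r₁ → disjoint v∈r₁ v∈r₂) , (λ { refl → x∉pre (row₂⊆ v∈r₂) }) ]′ (∈-∷ʳ⁻ r₁ v∈)
      ; countBelow-rows = countBelow-rows-append
      ; length-rows = trans (cong (_+ length r₂) (length-∷ʳ r₁ x)) (trans (cong suc length-rows) (sym (length-∷ʳ pre x)))
      ; schensted = subst (λ row → ∀ v → MaxLength _ (countBelow v row)) (cong proj₂ (insertRow-all< r₁ r₁<x))
          (schensted-step sorted₁ (x∉pre ∘ row₁⊆) schensted)
      ; ballot = λ k → ≤-trans (ballot k) (countBelow-∷ʳ-mono k r₁ x)
      ; between-after = between-after-append }

  module _ (avoids : Avoids321List (pre ∷ʳ x)) (b : Bump x r₁) where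
    open Bump b renaming (bumped to y; sorted to sorted′)

    private
      r₁′ : List ℕ
      r₁′ = insertedRow x r₁

    row₂<bumped : All (_< y) r₂
    row₂<bumped = All.tabulate below
      where
      y∈pre : y ∈ pre
      y∈pre = row₁⊆ bumped∈
      below : ∀ {z} → z ∈ r₂ → z < y
      below {z} z∈ with <-cmp z y
      ... | tri< z<y _ _ = z<y
      ... | tri≈ _ refl _ = contradiction z∈ (disjoint bumped∈)
      ... | tri> _ _ y<z with pair-⊆ pre y∈pre (row₂⊆ z∈) (λ { refl → <-irrefl refl y<z })
      ...   | inj₂ zy⊆ = ⊥-elim (avoids (++⁺ zy⊆ (refl ∷ [])) y<z x<bumped)
      ...   | inj₁ yz⊆ with between-after bumped∈ z∈ y<z yz⊆
      ...     | x′ , zx′⊆ , y<x′ , x′<z = ⊥-elim (avoids (++⁺ zx′⊆ (refl ∷ [])) x′<z (<-trans x<bumped y<x′))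

    row₂<row₁ : length r₂ < length r₁
    row₂<row₁ = begin-strict
      length r₂       ≡⟨ countBelow-all row₂<bumped ⟨
      countBelow y r₂ ≤⟨ ballot y ⟩
      countBelow y r₁ <⟨ countBelow<length r₁ bumped∈ ≤-refl ⟩
      length r₁       ∎
      where open ≤-Reasoning

    private
      disjoint-bump : ∀ {v} → v ∈ r₁′ → v ∉ r₂ ∷ʳ y
      disjoint-bump v∈ v∈′ with ∈-insertedRow v∈ | ∈-∷ʳ⁻ r₂ v∈′
      ... | inj₁ refl | inj₁ x∈r₂ = x∉pre (row₂⊆ x∈r₂)
      ... | inj₁ refl | inj₂ refl = <-irrefl refl x<bumped
      ... | inj₂ (v∈r₁ , _) | inj₁ v∈r₂ = disjoint v∈r₁ v∈r₂
      ... | inj₂ (_ , v≢y) | inj₂ v≡y = v≢y v≡y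

      countBelow-rows-bump : ∀ k → countBelow k r₁′ + countBelow k (r₂ ∷ʳ y) ≡ countBelow k (pre ∷ʳ x)
      countBelow-rows-bump k = begin
        countBelow k r₁′ + countBelow k (r₂ ∷ʳ y)                ≡⟨ cong (countBelow k r₁′ +_) (countBelow-++ k r₂ [ y ]) ⟩
        countBelow k r₁′ + (countBelow k r₂ + countBelow k [ y ]) ≡⟨ x∙yz≈zx∙y (countBelow k r₁′) (countBelow k r₂) (countBelow k [ y ]) ⟩
        countBelow k [ y ] + countBelow k r₁′ + countBelow k r₂  ≡⟨ cong (_+ countBelow k r₂) (countBelow-++ k [ y ] r₁′) ⟨
        countBelow k (y ∷ r₁′) + countBelow k r₂                 ≡⟨ cong (_+ countBelow k r₂) (countBelow-exchange k) ⟩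
        countBelow k (x ∷ r₁) + countBelow k r₂                  ≡⟨ cong (_+ countBelow k r₂) (countBelow-++ k [ x ] r₁) ⟩
        countBelow k [ x ] + countBelow k r₁ + countBelow k r₂   ≡⟨ xy∙z≈yz∙x (countBelow k [ x ]) (countBelow k r₁) (countBelow k r₂) ⟩
        countBelow k r₁ + countBelow k r₂ + countBelow k [ x ]   ≡⟨ cong (_+ countBelow k [ x ]) (countBelow-rows k) ⟩
        countBelow k pre + countBelow k [ x ]                    ≡⟨ countBelow-++ k pre [ x ] ⟨
        countBelow k (pre ∷ʳ x)                                  ∎
        where open ≡-Reasoning

      length-rows-bump : length r₁′ + length (r₂ ∷ʳ y) ≡ length (pre ∷ʳ x)
      length-rows-bump = begin
        length r₁′ + length (r₂ ∷ʳ y) ≡⟨ cong₂ _+_ length-insertedRow (length-∷ʳ r₂ y) ⟩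
        length r₁ + suc (length r₂)   ≡⟨ +-suc _ _ ⟩
        suc (length r₁ + length r₂)   ≡⟨ cong suc length-rows ⟩
        suc (length pre)              ≡⟨ length-∷ʳ pre x ⟨
        length (pre ∷ʳ x)             ∎
        where open ≡-Reasoning

      ballot-bump : ∀ k → countBelow k (r₂ ∷ʳ y) ≤ countBelow k r₁′
      ballot-bump k with y <? k
      ... | no y≮k = begin
        countBelow k (r₂ ∷ʳ y) ≡⟨ countBelow-∷ʳ-≥ r₂ (≮⇒≥ y≮k) ⟩
        countBelow k r₂        ≤⟨ ballot k ⟩
        countBelow k r₁        ≤⟨ countBelow-insertedRow-mono r₁ sorted₁ (x∉pre ∘ row₁⊆) ⟩
        countBelow k r₁′       ∎
        where open ≤-Reasoning
      ... | yes y<k = begin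
        countBelow k (r₂ ∷ʳ y) ≡⟨ countBelow-∷ʳ-< r₂ y<k ⟩
        suc (countBelow k r₂)  ≡⟨ cong suc (trans (countBelow-all (All.map (λ z<y → <-trans z<y y<k) row₂<bumped)) (sym (countBelow-all row₂<bumped))) ⟩
        suc (countBelow y r₂)  ≤⟨ s≤s (ballot y) ⟩
        suc (countBelow y r₁)  ≤⟨ countBelow-strict r₁ bumped∈ ≤-refl y<k ⟩
        countBelow k r₁        ≤⟨ countBelow-insertedRow-mono r₁ sorted₁ (x∉pre ∘ row₁⊆) ⟩
        countBelow k r₁′       ∎
        where open ≤-Reasoning

      between-after-bump : ∀ {v z} → v ∈ r₁′ → z ∈ r₂ ∷ʳ y → v < z → v ∷ z ∷ [] ⊆ pre ∷ʳ x →
        ∃[ x′ ] z ∷ x′ ∷ [] ⊆ pre ∷ʳ x × v < x′ × x′ < z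
      between-after-bump v∈ z∈ v<z vz⊆ with ∈-insertedRow v∈
      ... | inj₁ refl = contradiction (⊆-∷ʳ-head pre vz⊆) x∉pre
      ... | inj₂ (v∈r₁ , v≢y) with ∈-∷ʳ⁻ r₂ z∈
      ...   | inj₁ z∈r₂ = lift-between (between-after v∈r₁ z∈r₂ v<z (pair-before-x vz⊆ (row₂⊆ z∈r₂)))
      ...   | inj₂ refl = x , ++⁺ (from∈ (row₁⊆ bumped∈)) (refl ∷ []) , v<x , x<bumped
        where
        v<x : _ < x
        v<x with <-cmp _ x
        ... | tri< v<x _ _ = v<x
        ... | tri≈ _ refl _ = contradiction (row₁⊆ v∈r₁) x∉pre
        ... | tri> _ _ x<v = contradiction (bumped-least v∈r₁ x<v) (<⇒≱ v<z)

    rowsInv-bump : RowsInv (pre ∷ʳ x) r₁′ (r₂ ∷ʳ y)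
    rowsInv-bump = record
      { sorted₁ = sorted′
      ; row₁⊆ = λ v∈ → [ (λ { refl → ∈-∷ʳ-last pre }) , ∈-++⁺ˡ ∘ row₁⊆ ∘ proj₁ ]′ (∈-insertedRow v∈)
      ; row₂⊆ = λ v∈ → [ ∈-++⁺ˡ ∘ row₂⊆ , (λ { refl → ∈-++⁺ˡ (row₁⊆ bumped∈) }) ]′ (∈-∷ʳ⁻ r₂ v∈)
      ; disjoint = disjoint-bump
      ; countBelow-rows = countBelow-rows-bump
      ; length-rows = length-rows-bump
      ; schensted = schensted-step sorted₁ (x∉pre ∘ row₁⊆) schensted
      ; ballot = ballot-bump
      ; between-after = between-after-bump }

record RSInv (pre r₁ r₂ q₁ q₂ : List ℕ) : Set where
  field
    rows : RowsInv pre r₁ r₂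
    recording : RecordingInv (length pre) q₁ q₂
    shape₁ : length q₁ ≡ length r₁
    shape₂ : length q₂ ≡ length r₂

rsInv-empty : RSInv [] [] [] [] []
rsInv-empty = record { rows = rowsInv-empty ; recording = recordingInv-empty ; shape₁ = refl ; shape₂ = refl }

record RSStep (pre : List ℕ) (x : ℕ) (r₁ r₂ q₁ q₂ : List ℕ) : Set where
  field
    r₁′ r₂′ q₁′ q₂′ : List ℕ
    row : ℕ
    insertT≡ : insertT x (twoRow r₁ r₂) ≡ (twoRow r₁′ r₂′ , row)
    addAt≡ : addAt (length pre) row (twoRow q₁ q₂) ≡ twoRow q₁′ q₂′
    invariant : RSInv (pre ∷ʳ x) r₁′ r₂′ q₁′ q₂′

rs-step : ∀ {pre x r₁ r₂ q₁ q₂} → x ∉ pre → Avoids321List (pre ∷ʳ x) → RSInv pre r₁ r₂ q₁ q₂ → RSStep pre x r₁ r₂ q₁ q₂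
rs-step {pre} {x} {r₁} {r₂} {q₁} {q₂} x∉pre avoids I with rowInsertion x r₁ sorted₁ (x∉pre ∘ row₁⊆)
  where open RSInv I; open RowsInv rows
... | appends r₁<x = record
  { r₁′ = r₁ ∷ʳ x ; r₂′ = r₂ ; q₁′ = q₁ ∷ʳ length pre ; q₂′ = q₂ ; row = 0
  ; insertT≡ = insertT-append r₂ (insertRow-all< r₁ r₁<x)
  ; addAt≡ = addAt-row₁ (length pre) q₁ q₂
  ; invariant = record
    { rows = rowsInv-append rows x∉pre r₁<x
    ; recording = subst (λ t → RecordingInv t _ _) (sym (length-∷ʳ pre x)) (recordRow₁ recording)
    ; shape₁ = trans (length-∷ʳ q₁ _) (trans (cong suc shape₁) (sym (length-∷ʳ r₁ x)))
    ; shape₂ = shape₂ } }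
  where open RSInv I
... | bumps b = record
  { r₁′ = insertedRow x r₁ ; r₂′ = r₂ ∷ʳ bumped ; q₁′ = q₁ ; q₂′ = q₂ ∷ʳ length pre ; row = 1
  ; insertT≡ = insertT-bump r₂ insertRow≡ (row₂<bumped rows x∉pre avoids b)
  ; addAt≡ = addAt-row₂ (length pre) q₁ q₂
  ; invariant = record
    { rows = rowsInv-bump rows x∉pre avoids b
    ; recording = subst (λ t → RecordingInv t _ _) (sym (length-∷ʳ pre x))
        (recordRow₂ recording (subst₂ _<_ (sym shape₂) (sym shape₁) (row₂<row₁ rows x∉pre avoids b)))
    ; shape₁ = trans shape₁ (sym length-insertedRow)
    ; shape₂ = trans (length-∷ʳ q₂ _) (trans (cong suc shape₂) (sym (length-∷ʳ r₂ bumped))) } }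
  where open RSInv I; open Bump b

record RSOutcome (w : List ℕ) (start : ℕ) (xs : List ℕ) (P Q : Tableau) : Set where
  field
    r₁ r₂ q₁ q₂ : List ℕ
    rsFrom≡ : rsFrom start xs (P , Q) ≡ (twoRow r₁ r₂ , twoRow q₁ q₂)
    invariant : RSInv w r₁ r₂ q₁ q₂

rsFrom-∷ : ∀ pos x xs P Q {P′ k} → insertT x P ≡ (P′ , k) → rsFrom pos (x ∷ xs) (P , Q) ≡ rsFrom (suc pos) xs (P′ , addAt pos k Q)
rsFrom-∷ pos x xs P Q eq rewrite eq = refl

module _ {w : List ℕ} (w-distinct : AllPairs _≢_ w) (w-avoids : Avoids321List w) where

  rs-run : ∀ xs {pre r₁ r₂ q₁ q₂} → pre ++ xs ≡ w → RSInv pre r₁ r₂ q₁ q₂ →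
    RSOutcome w (length pre) xs (twoRow r₁ r₂) (twoRow q₁ q₂)
  rs-run [] {pre} {r₁} {r₂} {q₁} {q₂} pre≡w I = record
    { r₁ = r₁ ; r₂ = r₂ ; q₁ = q₁ ; q₂ = q₂ ; rsFrom≡ = refl
    ; invariant = subst (λ ws → RSInv ws r₁ r₂ q₁ q₂) (trans (sym (++-identityʳ pre)) pre≡w) I }
  rs-run (x ∷ xs) {pre} {r₁} {r₂} {q₁} {q₂} pre++xs≡w I = record
    { r₁ = Rest.r₁ ; r₂ = Rest.r₂ ; q₁ = Rest.q₁ ; q₂ = Rest.q₂
    ; rsFrom≡ = begin
      rsFrom (length pre) (x ∷ xs) (twoRow r₁ r₂ , twoRow q₁ q₂)   ≡⟨ rsFrom-∷ (length pre) x xs (twoRow r₁ r₂) _ insertT≡ ⟩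
      rsFrom (suc (length pre)) xs (twoRow r₁′ r₂′ , addAt (length pre) row (twoRow q₁ q₂))
        ≡⟨ cong₂ (λ t Q → rsFrom t xs (twoRow r₁′ r₂′ , Q)) (sym (length-∷ʳ pre x)) addAt≡ ⟩
      rsFrom (length (pre ∷ʳ x)) xs (twoRow r₁′ r₂′ , twoRow q₁′ q₂′) ≡⟨ Rest.rsFrom≡ ⟩
      (twoRow Rest.r₁ Rest.r₂ , twoRow Rest.q₁ Rest.q₂) ∎
    ; invariant = Rest.invariant }
    where
    open ≡-Reasoning
    pre∷ʳx++xs≡w : (pre ∷ʳ x) ++ xs ≡ w
    pre∷ʳx++xs≡w = trans (++-assoc pre [ x ] xs) pre++xs≡w
    pre∷ʳx⊆w : pre ∷ʳ x ⊆ w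
    pre∷ʳx⊆w = subst (pre ∷ʳ x ⊆_) pre∷ʳx++xs≡w (++⁺ʳ xs ⊆-refl)
    x∉pre : x ∉ pre
    x∉pre x∈ = All.lookup (proj₂ (AllPairs-∷ʳ⁻ pre (AllPairs-resp-⊆ pre∷ʳx⊆w w-distinct))) x∈ refl
    avoids : Avoids321List (pre ∷ʳ x)
    avoids abc⊆ = w-avoids (⊆-trans abc⊆ pre∷ʳx⊆w)
    open RSStep (rs-step x∉pre avoids I)
    module Rest = RSOutcome (rs-run xs pre∷ʳx++xs≡w invariant)

  -- Inserting a letter into [] and into [ [] ] gives the same tableau, so once the first
  -- letter is in, RS runs on two-row tableaux; this is where a nonempty word is needed.
  rs-twoRow : ∀ {x xs} → x ∷ xs ≡ w → RSOutcome w 0 w [] []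
  rs-twoRow {x} {xs} refl = record { r₁ = r₁ ; r₂ = r₂ ; q₁ = q₁ ; q₂ = q₂ ; rsFrom≡ = rsFrom≡ ; invariant = invariant }
    where open RSOutcome (rs-run (x ∷ xs) refl rsInv-empty)

-- Lattice paths and their tunnels

count-++ : ∀ s X Y → count s (X ++ Y) ≡ count s X + count s Y
count-++ u [] Y = refl
count-++ d [] Y = refl
count-++ u (u ∷ X) Y = cong suc (count-++ u X Y)
count-++ u (d ∷ X) Y = count-++ u X Y
count-++ d (u ∷ X) Y = count-++ d X Y
count-++ d (d ∷ X) Y = cong suc (count-++ d X Y)

count-reverse : ∀ s W → count s (reverse W) ≡ count s W
count-reverse s [] = refl
count-reverse s (t ∷ W) = begin
  count s (reverse (t ∷ W))          ≡⟨ cong (count s) (unfold-reverse t W) ⟩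
  count s (reverse W ∷ʳ t)           ≡⟨ count-++ s (reverse W) [ t ] ⟩
  count s (reverse W) + count s [ t ] ≡⟨ cong (_+ count s [ t ]) (count-reverse s W) ⟩
  count s W + count s [ t ]          ≡⟨ +-comm (count s W) _ ⟩
  count s [ t ] + count s W          ≡⟨ count-++ s [ t ] W ⟨
  count s (t ∷ W)                    ∎
  where open ≡-Reasoning

count-u-flip : ∀ W → count u (map flip W) ≡ count d W
count-u-flip [] = refl
count-u-flip (u ∷ W) = count-u-flip W
count-u-flip (d ∷ W) = cong suc (count-u-flip W)

count-d-flip : ∀ W → count d (map flip W) ≡ count u W
count-d-flip [] = refl
count-d-flip (u ∷ W) = cong suc (count-d-flip W)
count-d-flip (d ∷ W) = count-d-flip W

count-u-reversal : ∀ W → count u (reversal W) ≡ count d W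
count-u-reversal W = trans (count-reverse u (map flip W)) (count-u-flip W)

count-d-reversal : ∀ W → count d (reversal W) ≡ count u W
count-d-reversal W = trans (count-reverse d (map flip W)) (count-d-flip W)

reversal-applyUpTo : ∀ f n → reversal (applyUpTo f n) ≡ applyDownFrom (flip ∘ f) n
reversal-applyUpTo f n = trans (cong reverse (map-applyUpTo f flip n)) (reverse-applyUpTo (flip ∘ f) n)

count-u+count-d : ∀ W → count u W + count d W ≡ length W
count-u+count-d [] = refl
count-u+count-d (u ∷ W) = cong suc (count-u+count-d W)
count-u+count-d (d ∷ W) = trans (+-suc (count u W) (count d W)) (cong suc (count-u+count-d W))

Tunnel : Set
Tunnel = List Step × List Step × List Step

shift : Step → Tunnel → Tunnel
shift s (A , B , C) = (s ∷ A , B , C)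

consB : Step → List Step × List Step → List Step × List Step
consB s (B , C) = (s ∷ B , C)

-- The splittings R = B ++ d ∷ C at the first step d taking the path, started at
-- height h, below its starting level; there is at most one.
closings : ℕ → List Step → List (List Step × List Step)
closings h [] = []
closings h (u ∷ R) = map (consB u) (closings (suc h) R)
closings zero (d ∷ R) = ([] , R) ∷ []
closings (suc h) (d ∷ R) = map (consB d) (closings h R)

heads : Step → List Step → List Tunnel
heads u D = map ([] ,_) (closings 0 D)
heads d D = []

tunnelList : List Step → List Tunnel
tunnelList [] = []
tunnelList (s ∷ D) = heads s D ++ map (shift s) (tunnelList D)

module _ where
  private
    closeAfter : List Step → ℕ → List Step × List Step → List Tunnel
    closeAfter A h (B , d ∷ C) = if dyckFrom h B then (A , B , C) ∷ [] else []
    closeAfter A h (B , u ∷ C) = []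
    closeAfter A h (B , []) = []

    openAt : List Step × List Step → List Tunnel
    openAt (A , u ∷ R) = concatMap (closeAfter A 0) (splits R)
    openAt (A , _) = []

    tunnels≡openAt : ∀ D → tunnels D ≡ concatMap openAt (splits D)
    tunnels≡openAt D = concatMap-cong
      (λ { (A , u ∷ R) → concatMap-cong (λ { (B , d ∷ C) → refl ; (B , u ∷ C) → refl ; (B , []) → refl }) (splits R)
         ; (A , d ∷ R) → refl
         ; (A , []) → refl })
      (splits D)

    consBₜ : Step → Tunnel → Tunnel
    consBₜ s (A , B , C) = (A , s ∷ B , C)

    closeAfter-u : ∀ A h p → closeAfter A h (consB u p) ≡ map (consBₜ u) (closeAfter A (suc h) p)
    closeAfter-u A h (B , d ∷ C) with dyckFrom (suc h) B
    ... | true = refl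
    ... | false = refl
    closeAfter-u A h (B , u ∷ C) = refl
    closeAfter-u A h (B , []) = refl

    closeAfter-d : ∀ A h p → closeAfter A (suc h) (consB d p) ≡ map (consBₜ d) (closeAfter A h p)
    closeAfter-d A h (B , d ∷ C) with dyckFrom h B
    ... | true = refl
    ... | false = refl
    closeAfter-d A h (B , u ∷ C) = refl
    closeAfter-d A h (B , []) = refl

    closeAfter-d₀ : ∀ A p → closeAfter A 0 (consB d p) ≡ []
    closeAfter-d₀ A (B , d ∷ C) = refl
    closeAfter-d₀ A (B , u ∷ C) = refl
    closeAfter-d₀ A (B , []) = refl

    module Descend (A : List Step) (h : ℕ) (R : List Step) where
      descend : ∀ s {h′} → (∀ p → closeAfter A h (consB s p) ≡ map (consBₜ s) (closeAfter A h′ p)) →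
        concatMap (closeAfter A h′) (splits R) ≡ map (A ,_) (closings h′ R) →
        concatMap (closeAfter A h) (map (consB s) (splits R)) ≡ map (A ,_) (map (consB s) (closings h′ R))
      descend s {h′} step ih = begin
        concatMap (closeAfter A h) (map (consB s) (splits R))   ≡⟨ concatMap-map (closeAfter A h) (consB s) (splits R) ⟩
        concatMap (closeAfter A h ∘ consB s) (splits R)        ≡⟨ concatMap-cong step (splits R) ⟩
        concatMap (map (consBₜ s) ∘ closeAfter A h′) (splits R)      ≡⟨ map-concatMap (consBₜ s) (closeAfter A h′) (splits R) ⟨
        map (consBₜ s) (concatMap (closeAfter A h′) (splits R))      ≡⟨ cong (map (consBₜ s)) ih ⟩
        map (consBₜ s) (map (A ,_) (closings h′ R))                  ≡⟨ map-∘ (closings h′ R) ⟨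
        map (consBₜ s ∘ (A ,_)) (closings h′ R)                      ≡⟨ map-∘ (closings h′ R) ⟩
        map (A ,_) (map (consB s) (closings h′ R))              ∎
        where open ≡-Reasoning

    closeAfter-splits : ∀ A h R → concatMap (closeAfter A h) (splits R) ≡ map (A ,_) (closings h R)
    closeAfter-splits A h [] = refl
    closeAfter-splits A h (u ∷ R) = descend u (closeAfter-u A h) (closeAfter-splits A (suc h) R)
      where open Descend A h R
    closeAfter-splits A zero (d ∷ R) = cong ((A , [] , R) ∷_) (begin
      concatMap (closeAfter A 0) (map (consB d) (splits R)) ≡⟨ concatMap-map (closeAfter A 0) (consB d) (splits R) ⟩
      concatMap (closeAfter A 0 ∘ consB d) (splits R)      ≡⟨ concatMap-cong (closeAfter-d₀ A) (splits R) ⟩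
      concatMap (λ _ → []) (splits R)                          ≡⟨ concatMap-empty (splits R) ⟩
      []                                                       ∎)
      where open ≡-Reasoning
            concatMap-empty : ∀ (ps : List (List Step × List Step)) → concatMap (λ _ → ([] {A = Tunnel})) ps ≡ []
            concatMap-empty [] = refl
            concatMap-empty (_ ∷ ps) = concatMap-empty ps
    closeAfter-splits A (suc h) (d ∷ R) = descend d (closeAfter-d A h) (closeAfter-splits A h R)
      where open Descend A (suc h) R

    openAt-shift : ∀ s p → openAt (consB s p) ≡ map (shift s) (openAt p)
    openAt-shift s (A , u ∷ R) = begin
      concatMap (closeAfter (s ∷ A) 0) (splits R) ≡⟨ closeAfter-splits (s ∷ A) 0 R ⟩
      map (s ∷ A ,_) (closings 0 R)               ≡⟨ map-∘ (closings 0 R) ⟩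
      map (shift s) (map (A ,_) (closings 0 R))   ≡⟨ cong (map (shift s)) (closeAfter-splits A 0 R) ⟨
      map (shift s) (concatMap (closeAfter A 0) (splits R)) ∎
      where open ≡-Reasoning
    openAt-shift s (A , d ∷ R) = refl
    openAt-shift s (A , []) = refl

    openAt-heads : ∀ s D → openAt ([] , s ∷ D) ≡ heads s D
    openAt-heads u D = closeAfter-splits [] 0 D
    openAt-heads d D = refl

    openAt-splits : ∀ D → concatMap openAt (splits D) ≡ tunnelList D
    openAt-splits [] = refl
    openAt-splits (s ∷ D) = cong₂ _++_ (openAt-heads s D) (begin
      concatMap openAt (map (consB s) (splits D))   ≡⟨ concatMap-map openAt (consB s) (splits D) ⟩
      concatMap (openAt ∘ consB s) (splits D)       ≡⟨ concatMap-cong (openAt-shift s) (splits D) ⟩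
      concatMap (map (shift s) ∘ openAt) (splits D) ≡⟨ map-concatMap (shift s) openAt (splits D) ⟨
      map (shift s) (concatMap openAt (splits D))   ≡⟨ cong (map (shift s)) (openAt-splits D) ⟩
      map (shift s) (tunnelList D)                  ∎)
      where open ≡-Reasoning

  tunnels≡tunnelList : ∀ D → tunnels D ≡ tunnelList D
  tunnels≡tunnelList D = trans (tunnels≡openAt D) (openAt-splits D)

shiftBy : List Step → Tunnel → Tunnel
shiftBy X (A , B , C) = (X ++ A , B , C)

extendBy : List Step → Tunnel → Tunnel
extendBy Y (A , B , C) = (A , B , C ++ Y)

StartsFrom : ℕ → Tunnel → Set
StartsFrom m (A , _ , _) = m ≤ length A

startsFrom? : ∀ m → Decidable (StartsFrom m)
startsFrom? m (A , _ , _) = m ≤? length A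

EndsBy : ℕ → Tunnel → Set
EndsBy m (A , B , _) = suc (suc (length A + length B)) ≤ m

endsBy? : ∀ m → Decidable (EndsBy m)
endsBy? m (A , B , _) = suc (suc (length A + length B)) ≤? m

heads-start : ∀ s D → All (λ t → proj₁ t ≡ []) (heads s D)
heads-start u D = Allₚ.map⁺ (All.universal (λ _ → refl) (closings 0 D))
heads-start d D = []

filter-startsFrom : ∀ X Y → filter (startsFrom? (length X)) (tunnelList (X ++ Y)) ≡ map (shiftBy X) (tunnelList Y)
filter-startsFrom [] Y = trans (filter-all (startsFrom? 0) (All.universal (λ _ → z≤n) _)) (sym (map-id (tunnelList Y)))
filter-startsFrom (s ∷ X) Y = begin
  filter P? (heads s (X ++ Y) ++ map (shift s) (tunnelList (X ++ Y)))
    ≡⟨ filter-++ P? (heads s (X ++ Y)) _ ⟩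
  filter P? (heads s (X ++ Y)) ++ filter P? (map (shift s) (tunnelList (X ++ Y)))
    ≡⟨ cong₂ _++_ (filter-none P? (All.map (λ { refl () }) (heads-start s (X ++ Y))))
                  (filter-map P? (startsFrom? (length X)) (shift s) s≤s⁻¹ s≤s (tunnelList (X ++ Y))) ⟩
  map (shift s) (filter (startsFrom? (length X)) (tunnelList (X ++ Y)))
    ≡⟨ cong (map (shift s)) (filter-startsFrom X Y) ⟩
  map (shift s) (map (shiftBy X) (tunnelList Y))
    ≡⟨ map-∘ (tunnelList Y) ⟨
  map (shiftBy (s ∷ X)) (tunnelList Y) ∎
  where
  open ≡-Reasoning
  P? : Decidable (StartsFrom (suc (length X)))
  P? = startsFrom? (suc (length X))

ShorterThan : ℕ → List Step × List Step → Set
ShorterThan m (B , _) = length B < m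

shorterThan? : ∀ m → Decidable (ShorterThan m)
shorterThan? m (B , _) = length B <? m

descend-++ : ∀ s (X Y : List Step) (ps qs : List (List Step × List Step)) →
  filter (shorterThan? (length X)) ps ≡ map (map₂ (_++ Y)) qs →
  filter (shorterThan? (suc (length X))) (map (consB s) ps) ≡ map (map₂ (_++ Y)) (map (consB s) qs)
descend-++ s X Y ps qs ih = begin
  filter (shorterThan? (suc (length X))) (map (consB s) ps)
    ≡⟨ filter-map (shorterThan? (suc (length X))) (shorterThan? (length X)) (consB s) s≤s⁻¹ s≤s ps ⟩
  map (consB s) (filter (shorterThan? (length X)) ps) ≡⟨ cong (map (consB s)) ih ⟩
  map (consB s) (map (map₂ (_++ Y)) qs)                          ≡⟨ map-∘ qs ⟨
  map (consB s ∘ map₂ (_++ Y)) qs                                ≡⟨ map-∘ qs ⟩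
  map (map₂ (_++ Y)) (map (consB s) qs)                          ∎
  where open ≡-Reasoning

closings-++ : ∀ h X Y → filter (shorterThan? (length X)) (closings h (X ++ Y)) ≡ map (map₂ (_++ Y)) (closings h X)
closings-++ h [] Y = filter-none (shorterThan? 0) (All.universal (λ _ ()) (closings h Y))
closings-++ h (u ∷ X) Y = descend-++ u X Y (closings (suc h) (X ++ Y)) (closings (suc h) X) (closings-++ (suc h) X Y)
closings-++ zero (d ∷ X) Y = filter-accept (shorterThan? (suc (length X))) {xs = []} (s≤s z≤n)
closings-++ (suc h) (d ∷ X) Y = descend-++ d X Y (closings h (X ++ Y)) (closings h X) (closings-++ h X Y)

heads-endsBy : ∀ s X Y → filter (endsBy? (suc (length X))) (heads s (X ++ Y)) ≡ map (extendBy Y) (heads s X)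
heads-endsBy u X Y = begin
  filter (endsBy? (suc (length X))) (map ([] ,_) (closings 0 (X ++ Y)))
    ≡⟨ filter-map (endsBy? (suc (length X))) (shorterThan? (length X)) ([] ,_) s≤s⁻¹ s≤s (closings 0 (X ++ Y)) ⟩
  map ([] ,_) (filter (shorterThan? (length X)) (closings 0 (X ++ Y))) ≡⟨ cong (map ([] ,_)) (closings-++ 0 X Y) ⟩
  map ([] ,_) (map (map₂ (_++ Y)) (closings 0 X))                      ≡⟨ map-∘ (closings 0 X) ⟨
  map (([] ,_) ∘ map₂ (_++ Y)) (closings 0 X)                          ≡⟨ map-∘ (closings 0 X) ⟩
  map (extendBy Y) (map ([] ,_) (closings 0 X))                        ∎
  where open ≡-Reasoning
heads-endsBy d X Y = refl

filter-endsBy : ∀ X Y → filter (endsBy? (length X)) (tunnelList (X ++ Y)) ≡ map (extendBy Y) (tunnelList X)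
filter-endsBy [] Y = filter-none (endsBy? 0) (All.universal (λ _ ()) (tunnelList Y))
filter-endsBy (s ∷ X) Y = begin
  filter P? (heads s (X ++ Y) ++ map (shift s) (tunnelList (X ++ Y)))
    ≡⟨ filter-++ P? (heads s (X ++ Y)) _ ⟩
  filter P? (heads s (X ++ Y)) ++ filter P? (map (shift s) (tunnelList (X ++ Y)))
    ≡⟨ cong₂ _++_ (heads-endsBy s X Y) (filter-map P? (endsBy? (length X)) (shift s) s≤s⁻¹ s≤s (tunnelList (X ++ Y))) ⟩
  map (extendBy Y) (heads s X) ++ map (shift s) (filter (endsBy? (length X)) (tunnelList (X ++ Y)))
    ≡⟨ cong (map (extendBy Y) (heads s X) ++_) (trans (cong (map (shift s)) (filter-endsBy X Y)) (sym (map-∘ (tunnelList X)))) ⟩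
  map (extendBy Y) (heads s X) ++ map (shift s ∘ extendBy Y) (tunnelList X)
    ≡⟨ cong (map (extendBy Y) (heads s X) ++_) (map-∘ (tunnelList X)) ⟩
  map (extendBy Y) (heads s X) ++ map (extendBy Y) (map (shift s) (tunnelList X))
    ≡⟨ map-++ (extendBy Y) (heads s X) _ ⟨
  map (extendBy Y) (tunnelList (s ∷ X)) ∎
  where
  open ≡-Reasoning
  P? : Decidable (EndsBy (suc (length X)))
  P? = endsBy? (suc (length X))

Spans : ℕ → Tunnel → Set
Spans m (A , B , C) = suc (suc (length A + length B + length C)) ≡ m

closings-size : ∀ h R → All (λ p → suc (length (proj₁ p) + length (proj₂ p)) ≡ length R) (closings h R)
closings-size h [] = []
closings-size h (u ∷ R) = Allₚ.map⁺ (All.map (cong suc) (closings-size (suc h) R))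
closings-size zero (d ∷ R) = refl ∷ []
closings-size (suc h) (d ∷ R) = Allₚ.map⁺ (All.map (cong suc) (closings-size h R))

tunnelList-size : ∀ D → All (Spans (length D)) (tunnelList D)
tunnelList-size [] = []
tunnelList-size (s ∷ D) = Allₚ.++⁺ (heads-size s) (Allₚ.map⁺ (All.map (cong suc) (tunnelList-size D)))
  where
  heads-size : ∀ s → All (Spans (suc (length D))) (heads s D)
  heads-size u = Allₚ.map⁺ (All.map (cong suc) (closings-size 0 D))
  heads-size d = []

module _ (n : ℕ) where

  private
    startsFrom⇒right : ∀ {a b c} → suc (suc (a + b + c)) ≡ n + n → n ≤ a → c < a
    startsFrom⇒right {a} {b} {c} spans n≤a = <-≤-trans (≤-trans (n≤1+n _) c+2≤n) n≤a
      where
      c+2≤n : suc (suc c) ≤ n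
      c+2≤n = +-cancelˡ-≤ n _ _ (begin
        n + suc (suc c)         ≤⟨ +-monoˡ-≤ (suc (suc c)) (≤-trans n≤a (m≤m+n a b)) ⟩
        a + b + suc (suc c)     ≡⟨ trans (+-suc (a + b) (suc c)) (cong suc (+-suc (a + b) c)) ⟩
        suc (suc (a + b + c))   ≡⟨ spans ⟩
        n + n                   ∎)
        where open ≤-Reasoning

    endsBy⇒left : ∀ {a b c} → suc (suc (a + b + c)) ≡ n + n → suc (suc (a + b)) ≤ n → a < c
    endsBy⇒left {a} {b} {c} spans ends = <-≤-trans (<-≤-trans a<a+b+2 ends) n≤c
      where
      a<a+b+2 : a < suc (suc (a + b))
      a<a+b+2 = s≤s (≤-trans (m≤m+n a b) (n≤1+n _))
      n≤c : n ≤ c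
      n≤c = +-cancelˡ-≤ n _ _ (begin
        n + n                   ≡⟨ spans ⟨
        suc (suc (a + b)) + c   ≤⟨ +-monoˡ-≤ c ends ⟩
        n + c                   ∎)
        where open ≤-Reasoning

  -- The Boolean tests inside rightSideTunnels and leftSideTunnels are local definitions
  -- that cannot be named; they enter through their defining equations.
  rightSideTunnels≡ : ∀ D (ok : Tunnel → Bool) → (∀ A B C → ok (A , B , C) ≡ ((length C <ᵇ length A) ∧ not (length A <ᵇ n))) →
    length D ≡ n + n → length (filter (λ t → Bool.T? (ok t)) (tunnels D)) ≡ length (filter (startsFrom? n) (tunnelList D))
  rightSideTunnels≡ D ok ok≡ len = cong length (trans (cong (filter _) (tunnels≡tunnelList D))
    (filter-≐-on _ (startsFrom? n) (All.map (λ {t} → agree t) (tunnelList-size D))))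
    where
    agree : ∀ t → Spans (length D) t → (T (ok t) → StartsFrom n t) × (StartsFrom n t → T (ok t))
    agree (A , B , C) spans rewrite ok≡ A B C =
      (λ okt → not-<ᵇ⇒≥ (proj₂ (Equivalence.to T-∧ okt)))
      , λ n≤A → Equivalence.from T-∧ (<⇒<ᵇ (startsFrom⇒right (trans spans len) n≤A) , ≥⇒not-<ᵇ n≤A)

  leftSideTunnels≡ : ∀ D (ok : Tunnel → Bool) → (∀ A B C → ok (A , B , C) ≡ ((length A <ᵇ length C) ∧ not (n <ᵇ length A + length B + 2))) →
    length D ≡ n + n → length (filter (λ t → Bool.T? (ok t)) (tunnels D)) ≡ length (filter (endsBy? n) (tunnelList D))
  leftSideTunnels≡ D ok ok≡ len = cong length (trans (cong (filter _) (tunnels≡tunnelList D))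
    (filter-≐-on _ (endsBy? n) (All.map (λ {t} → agree t) (tunnelList-size D))))
    where
    agree : ∀ t → Spans (length D) t → (T (ok t) → EndsBy n t) × (EndsBy n t → T (ok t))
    agree (A , B , C) spans rewrite ok≡ A B C | +-comm (length A + length B) 2 =
      (λ okt → not-<ᵇ⇒≥ (proj₂ (Equivalence.to T-∧ okt)))
      , λ ends → Equivalence.from T-∧ (<⇒<ᵇ (endsBy⇒left {length A} {length B} {length C} (trans spans len) ends) , ≥⇒not-<ᵇ ends)

-- How far the path descends below its starting level.
depth : List Step → ℕ
depth [] = 0
depth (u ∷ W) = depth W ∸ 1
depth (d ∷ W) = suc (depth W)

closings-length-1 : ∀ h R → h < depth R → length (closings h R) ≡ 1
closings-length-1 h (u ∷ R) h<depth with depth R in depth≡ | h<depth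
... | suc m | h<m = trans (length-map (consB u) (closings (suc h) R)) (closings-length-1 (suc h) R (subst (suc h <_) (sym depth≡) (s≤s h<m)))
closings-length-1 zero (d ∷ R) _ = refl
closings-length-1 (suc h) (d ∷ R) (s≤s h<depth) = trans (length-map (consB d) (closings h R)) (closings-length-1 h R h<depth)

closings-length-0 : ∀ h R → depth R ≤ h → length (closings h R) ≡ 0
closings-length-0 h [] _ = refl
closings-length-0 h (u ∷ R) depth≤h = trans (length-map (consB u) (closings (suc h) R))
  (closings-length-0 (suc h) R (≤-trans (m≤n+m∸n (depth R) 1) (s≤s depth≤h)))
closings-length-0 (suc h) (d ∷ R) (s≤s depth≤h) = trans (length-map (consB d) (closings h R)) (closings-length-0 h R depth≤h)

tunnelCount : List Step → ℕ
tunnelCount W = length (tunnelList W)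

tunnelCount-∷ : ∀ s R → tunnelCount (s ∷ R) ≡ length (heads s R) + tunnelCount R
tunnelCount-∷ s R = trans (length-++ (heads s R)) (cong (length (heads s R) +_) (length-map (shift s) (tunnelList R)))

tunnelCount+depth : ∀ W → tunnelCount W + depth W ≡ count d W
tunnelCount+depth [] = refl
tunnelCount+depth (d ∷ R) = trans (cong (_+ suc (depth R)) (tunnelCount-∷ d R))
  (trans (+-suc (tunnelCount R) (depth R)) (cong suc (tunnelCount+depth R)))
tunnelCount+depth (u ∷ R) = trans (cong (_+ (depth R ∸ 1)) (tunnelCount-∷ u R)) (closes (depth R) refl)
  where
  heads-length : length (heads u R) ≡ length (closings 0 R)
  heads-length = length-map ([] ,_) (closings 0 R)
  closes : ∀ m → depth R ≡ m → length (heads u R) + tunnelCount R + (m ∸ 1) ≡ count d R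
  closes zero depth≡0 = begin
    length (heads u R) + tunnelCount R + 0 ≡⟨ +-identityʳ _ ⟩
    length (heads u R) + tunnelCount R     ≡⟨ cong (_+ tunnelCount R) (trans heads-length (closings-length-0 0 R (≤-reflexive depth≡0))) ⟩
    tunnelCount R                          ≡⟨ +-identityʳ _ ⟨
    tunnelCount R + 0                      ≡⟨ cong (tunnelCount R +_) depth≡0 ⟨
    tunnelCount R + depth R                ≡⟨ tunnelCount+depth R ⟩
    count d R                              ∎
    where open ≡-Reasoning
  closes (suc m) depth≡1+m = begin
    length (heads u R) + tunnelCount R + m
      ≡⟨ cong (λ c → c + tunnelCount R + m) (trans heads-length (closings-length-1 0 R (subst (0 <_) (sym depth≡1+m) (s≤s z≤n)))) ⟩
    suc (tunnelCount R + m)                ≡⟨ +-suc (tunnelCount R) m ⟨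
    tunnelCount R + suc m                  ≡⟨ cong (tunnelCount R +_) depth≡1+m ⟨
    tunnelCount R + depth R                ≡⟨ tunnelCount+depth R ⟩
    count d R                              ∎
    where open ≡-Reasoning

depth-≤ : ∀ h W → (∀ k → count d (take k W) ≤ h + count u (take k W)) → depth W ≤ h
depth-≤ h [] _ = z≤n
depth-≤ h (u ∷ W) bal = ∸-monoˡ-≤ 1 (depth-≤ (suc h) W (λ k → subst (count d (take k W) ≤_) (+-suc h _) (bal (suc k))))
depth-≤ zero (d ∷ W) bal with () ← bal 1
depth-≤ (suc h) (d ∷ W) bal = s≤s (depth-≤ h W (λ k → s≤s⁻¹ (bal (suc k))))

tunnelCount-ballot : ∀ W → (∀ k → count d (take k W) ≤ count u (take k W)) → tunnelCount W ≡ count d W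
tunnelCount-ballot W ballot = begin
  tunnelCount W           ≡⟨ +-identityʳ _ ⟨
  tunnelCount W + 0       ≡⟨ cong (tunnelCount W +_) (n≤0⇒n≡0 (depth-≤ 0 W ballot)) ⟨
  tunnelCount W + depth W ≡⟨ tunnelCount+depth W ⟩
  count d W               ∎
  where open ≡-Reasoning

Coballot : List Step → Set
Coballot [] = ⊤
Coballot (s ∷ W) = Coballot W × count u (s ∷ W) ≤ count d (s ∷ W)

count-d≤depth+count-u : ∀ W → count d W ≤ depth W + count u W
count-d≤depth+count-u [] = z≤n
count-d≤depth+count-u (d ∷ W) = s≤s (count-d≤depth+count-u W)
count-d≤depth+count-u (u ∷ W) = begin
  count d W                          ≤⟨ count-d≤depth+count-u W ⟩
  depth W + count u W                ≤⟨ +-monoˡ-≤ (count u W) (m≤n+m∸n (depth W) 1) ⟩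
  suc (depth W ∸ 1 + count u W)      ≡⟨ +-suc (depth W ∸ 1) (count u W) ⟨
  depth W ∸ 1 + suc (count u W)      ∎
  where open ≤-Reasoning

tunnelCount-coballot : ∀ W → Coballot W → tunnelCount W ≡ count u W
tunnelCount-coballot [] _ = refl
tunnelCount-coballot (d ∷ R) (cob , _) = trans (tunnelCount-∷ d R) (tunnelCount-coballot R cob)
tunnelCount-coballot (u ∷ R) (cob , u≤d) = trans (tunnelCount-∷ u R)
  (cong₂ _+_ (trans (length-map ([] ,_) (closings 0 R)) (closings-length-1 0 R 0<depth)) (tunnelCount-coballot R cob))
  where
  0<depth : 0 < depth R
  0<depth with depth R | count-d≤depth+count-u R
  ... | zero | d≤u = contradiction d≤u (<⇒≱ u≤d)
  ... | suc _ | _ = s≤s z≤n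

-- The lattice path of a standard two-row tableau

letter : List ℕ → ℕ → Step
letter r t = if memberB t r then u else d

rowWord≡ : ∀ n T → rowWord n T ≡ applyUpTo (letter (firstRow T)) n
rowWord≡ n T = trans (map-tabulate id (letter (firstRow T) ∘ toℕ)) (tabulate-toℕ n (letter (firstRow T)))

count-u-letters : ∀ {r} → AllPairs _≢_ r → ∀ k → count u (applyUpTo (letter r) k) ≡ countBelow k r
count-u-letters {r} r! zero = sym (countBelow-zero r)
count-u-letters {r} r! (suc k) = begin
  count u (applyUpTo (letter r) (suc k))                     ≡⟨ cong (count u) (applyUpTo-∷ʳ (letter r) k) ⟨
  count u (applyUpTo (letter r) k ∷ʳ letter r k)             ≡⟨ count-++ u (applyUpTo (letter r) k) [ letter r k ] ⟩
  count u (applyUpTo (letter r) k) + count u [ letter r k ]  ≡⟨ cong (_+ count u [ letter r k ]) (count-u-letters r! k) ⟩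
  countBelow k r + count u [ letter r k ]                    ≡⟨ last-letter (k ∈? r) ⟩
  countBelow (suc k) r                                       ∎
  where
  open ≡-Reasoning
  last-letter : Dec (k ∈ r) → countBelow k r + count u [ letter r k ] ≡ countBelow (suc k) r
  last-letter (yes k∈) rewrite ∈-memberB r k∈ = trans (+-comm _ 1) (sym (countBelow-suc-∈ r r! k∈))
  last-letter (no k∉) rewrite ∉-memberB r k∉ = trans (+-identityʳ _) (sym (countBelow-suc-∉ r k∉))

record StandardRows (n : ℕ) (r₁ r₂ : List ℕ) : Set where
  field
    distinct₁ : AllPairs _≢_ r₁
    partition : ∀ k → k ≤ n → countBelow k r₁ + countBelow k r₂ ≡ k
    ballot : ∀ k → countBelow k r₂ ≤ countBelow k r₁

  word : List Step
  word = applyUpTo (letter r₁) n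

  count-u-prefix : ∀ k → count u (applyUpTo (letter r₁) k) ≡ countBelow k r₁
  count-u-prefix = count-u-letters distinct₁

  count-d-prefix : ∀ k → k ≤ n → count d (applyUpTo (letter r₁) k) ≡ countBelow k r₂
  count-d-prefix k k≤n = +-cancelˡ-≡ (countBelow k r₁) _ _ (begin
    countBelow k r₁ + count d (applyUpTo (letter r₁) k)                   ≡⟨ cong (_+ count d (applyUpTo (letter r₁) k)) (count-u-prefix k) ⟨
    count u (applyUpTo (letter r₁) k) + count d (applyUpTo (letter r₁) k) ≡⟨ count-u+count-d (applyUpTo (letter r₁) k) ⟩
    length (applyUpTo (letter r₁) k)                                      ≡⟨ length-applyUpTo (letter r₁) k ⟩
    k                                                                     ≡⟨ partition k k≤n ⟨
    countBelow k r₁ + countBelow k r₂                                     ∎)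
    where open ≡-Reasoning

  word-ballot : ∀ k → count d (take k word) ≤ count u (take k word)
  word-ballot k with k ≤? n
  ... | yes k≤n rewrite take-applyUpTo (letter r₁) k≤n =
    subst₂ _≤_ (sym (count-d-prefix k k≤n)) (sym (count-u-prefix k)) (ballot k)
  ... | no k≰n rewrite take-all k word (subst (_≤ k) (sym (length-applyUpTo (letter r₁) n)) (<⇒≤ (≰⇒> k≰n))) =
    subst₂ _≤_ (sym (count-d-prefix n ≤-refl)) (sym (count-u-prefix n)) (ballot n)

  reversal-coballot : Coballot (reversal word)
  reversal-coballot = subst Coballot (sym (reversal-applyUpTo (letter r₁) n)) (coballot-down n ≤-refl)
    where
    suffix-counts : ∀ k → k ≤ n → count u (reversal (applyUpTo (letter r₁) k)) ≤ count d (reversal (applyUpTo (letter r₁) k))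
    suffix-counts k k≤n = begin
      count u (reversal (applyUpTo (letter r₁) k)) ≡⟨ count-u-reversal (applyUpTo (letter r₁) k) ⟩
      count d (applyUpTo (letter r₁) k)            ≡⟨ count-d-prefix k k≤n ⟩
      countBelow k r₂                              ≤⟨ ballot k ⟩
      countBelow k r₁                              ≡⟨ count-u-prefix k ⟨
      count u (applyUpTo (letter r₁) k)            ≡⟨ count-d-reversal (applyUpTo (letter r₁) k) ⟨
      count d (reversal (applyUpTo (letter r₁) k)) ∎
      where open ≤-Reasoning
    coballot-down : ∀ k → k ≤ n → Coballot (applyDownFrom (flip ∘ letter r₁) k)
    coballot-down zero _ = tt
    coballot-down (suc k) 1+k≤n = coballot-down k (<⇒≤ 1+k≤n) ,
      subst (λ W → count u W ≤ count d W) (reversal-applyUpTo (letter r₁) (suc k)) (suffix-counts (suc k) 1+k≤n)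

  count-u-reversed-word : count u (reversal word) ≡ countBelow n r₂
  count-u-reversed-word = trans (count-u-reversal word) (count-d-prefix n ≤-refl)

-- Chains of points and the matching

Point : Set
Point = ℕ × ℕ

_≺_ : Point → Point → Set
p ≺ q = proj₁ p < proj₁ q × proj₂ p < proj₂ q

_≺?_ : ∀ p q → Dec (p ≺ q)
p ≺? q = (proj₁ p <? proj₁ q) ×-dec (proj₂ p <? proj₂ q)

_≟ₚ_ : (p q : Point) → Dec (p ≡ q)
_≟ₚ_ = ×-≡-dec _≟_ _≟_

open import Data.List.Membership.DecPropositional _≟ₚ_ using () renaming (_∈?_ to _∈ₚ?_)

≺-asym : ∀ {p q} → p ≺ q → ¬ q ≺ p
≺-asym (p<q , _) (q<p , _) = <-asym p<q q<p

≺-irrefl : ∀ {p} → ¬ p ≺ p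
≺-irrefl (p<p , _) = <-irrefl refl p<p

ChainIn : List Point → List Point → Set
ChainIn S C = AllPairs _≺_ C × All (_∈ S) C

chain-remove : ∀ x C → AllPairs _≺_ C → ∃[ C′ ] C′ ⊆ C × x ∉ C′ × length C ≤ suc (length C′)
chain-remove x [] [] = [] , [] , (λ ()) , z≤n
chain-remove x (c ∷ C) (c≺ ∷ C!) with c ≟ₚ x
... | yes refl = C , skip c ⊆-refl , (λ x∈ → ≺-irrefl (All.lookup c≺ x∈)) , ≤-refl
... | no c≢x with chain-remove x C C!
...   | C′ , C′⊆ , x∉ , len = c ∷ C′ , refl ∷ C′⊆ , (λ { (here refl) → c≢x refl ; (there x∈) → x∉ x∈ }) , s≤s len

module _ {S T : List Point} (S⊆T : ∀ {x} → x ∈ S → x ∈ T) where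

  private
    chain-restrict : ∀ {C C′ ps} → ChainIn T C → C′ ⊆ C → All (_∉ C′) ps → (∀ {x} → x ∈ T → x ∈ ps ⊎ x ∈ S) → ChainIn S C′
    chain-restrict (C! , C∈T) C′⊆C ps∉ T⊆ps∪S =
      AllPairs-resp-⊆ C′⊆C C! , All.tabulate (λ {x} x∈C′ → [ (λ x∈ps → contradiction x∈C′ (All.lookup ps∉ x∈ps)) , id ]′
        (T⊆ps∪S (All.lookup C∈T (Any-resp-⊆ C′⊆C x∈C′))))

  MaxLength-addMinimum : ∀ {p m} → p ∈ T → (∀ {x} → x ∈ T → x ≡ p ⊎ x ∈ S) → (∀ {x} → x ∈ S → p ≺ x) →
    MaxLength (ChainIn S) m → MaxLength (ChainIn T) (suc m)
  MaxLength-addMinimum {p} {m} p∈T T⊆p∪S p≺S M = record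
    { witness = p ∷ witness
    ; witness-satisfies = (All.map p≺S (proj₂ witness-satisfies) ∷ proj₁ witness-satisfies) , (p∈T ∷ All.map S⊆T (proj₂ witness-satisfies))
    ; witness-length = cong suc witness-length
    ; bounded = bounded′ }
    where
    open MaxLength M
    bounded′ : ∀ {C} → ChainIn T C → length C ≤ suc m
    bounded′ {C} C-ok with chain-remove p C (proj₁ C-ok)
    ... | C′ , C′⊆C , p∉C′ , len = ≤-trans len (s≤s (bounded (chain-restrict C-ok C′⊆C (p∉C′ ∷ []) (Sum.map₁ here ∘ T⊆p∪S))))

  MaxLength-addIncomparable : ∀ {p q m} → p ∈ T → q ∈ T → p ≢ q → ¬ p ≺ q → ¬ q ≺ p →
    (∀ {x} → x ∈ T → x ≡ p ⊎ x ≡ q ⊎ x ∈ S) → (M : MaxLength (ChainIn S) m) →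
    (∃[ a ] a ∈ T × All (a ≺_) (MaxLength.witness M)) → MaxLength (ChainIn T) (suc m)
  MaxLength-addIncomparable {p} {q} {m} p∈T q∈T p≢q p⊀q q⊀p T⊆pq∪S M (a , a∈T , a≺W) = record
    { witness = a ∷ witness
    ; witness-satisfies = (a≺W ∷ proj₁ witness-satisfies) , (a∈T ∷ All.map S⊆T (proj₂ witness-satisfies))
    ; witness-length = cong suc witness-length
    ; bounded = bounded′ }
    where
    open MaxLength M
    T⊆pq∪S′ : ∀ {x} → x ∈ T → x ∈ p ∷ q ∷ [] ⊎ x ∈ S
    T⊆pq∪S′ x∈T = [ (λ { refl → inj₁ (here refl) }) , [ (λ { refl → inj₁ (there (here refl)) }) , inj₂ ]′ ]′ (T⊆pq∪S x∈T)
    not-both : ∀ {C} → AllPairs _≺_ C → p ∈ C → q ∉ C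
    not-both C! p∈ q∈ = [ p≢q , [ p⊀q , q⊀p ]′ ]′ (AllPairs-comparable C! p∈ q∈)
    bounded′ : ∀ {C} → ChainIn T C → length C ≤ suc m
    bounded′ {C} C-ok@(C! , _) with p ∈ₚ? C
    ... | yes p∈C with chain-remove p C C!
    ...   | C′ , C′⊆C , p∉C′ , len =
      ≤-trans len (s≤s (bounded (chain-restrict C-ok C′⊆C (p∉C′ ∷ (not-both C! p∈C ∘ Any-resp-⊆ C′⊆C) ∷ []) T⊆pq∪S′)))
    bounded′ {C} C-ok@(C! , _) | no p∉C with chain-remove q C C!
    ...   | C′ , C′⊆C , q∉C′ , len =
      ≤-trans len (s≤s (bounded (chain-restrict C-ok C′⊆C ((p∉C ∘ Any-resp-⊆ C′⊆C) ∷ q∉C′ ∷ []) T⊆pq∪S′)))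

MaxLength-chain : ∀ {S} → AllPairs _≺_ S → MaxLength (ChainIn S) (length S)
MaxLength-chain {S} S! = record
  { witness = S
  ; witness-satisfies = S! , All.tabulate id
  ; witness-length = refl
  ; bounded = λ (C! , C∈S) → length-mono-≤ (sortedSubset⇒sublist ≺-asym C! S! C∈S) }

IsExcedance : Point → Set
IsExcedance (i , v) = i < v

IsAntiexcedance : Point → Set
IsAntiexcedance (j , v) = v < j

module _ {i si j sj : ℕ} {E A : List Point} where

  matchCount-skipAntiexcedance : j < i → matchCount ((i , si) ∷ E) ((j , sj) ∷ A) ≡ matchCount ((i , si) ∷ E) A
  matchCount-skipAntiexcedance j<i rewrite <ᵇ-true j<i = refl

  matchCount-skipExcedance : i ≤ j → si < sj → matchCount ((i , si) ∷ E) ((j , sj) ∷ A) ≡ matchCount E ((j , sj) ∷ A)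
  matchCount-skipExcedance i≤j si<sj rewrite <ᵇ-false i≤j | <ᵇ-true si<sj = refl

  matchCount-match : i ≤ j → sj ≤ si → matchCount ((i , si) ∷ E) ((j , sj) ∷ A) ≡ suc (matchCount E A)
  matchCount-match i≤j sj≤si rewrite <ᵇ-false i≤j | <ᵇ-false sj≤si = refl

  matched-pair-precedes : i ≤ j → sj ≤ si → All ((i , si) ≺_) E → All ((j , sj) ≺_) A →
    All IsExcedance E → All IsAntiexcedance A → ∀ {W} → ChainIn (E ++ A) W →
    All ((i , si) ≺_) W ⊎ All ((j , sj) ≺_) W
  matched-pair-precedes i≤j sj≤si i≺E j≺A E-exc A-anti {W} (W! , W∈) with all? ((i , si) ≺?_) W
  ... | yes i≺W = inj₁ i≺W
  ... | no i⊀W with find (¬All⇒Any¬ ((i , si) ≺?_) W i⊀W)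
  ...   | g , g∈W , i⊀g = inj₂ (All.tabulate j≺)
    where
    g∈A : g ∈ A
    g∈A with ∈-++⁻ E (All.lookup W∈ g∈W)
    ... | inj₁ g∈E = contradiction (All.lookup i≺E g∈E) i⊀g
    ... | inj₂ g∈A = g∈A
    j≺g : (j , sj) ≺ g
    j≺g = All.lookup j≺A g∈A
    g≤si : proj₂ g ≤ si
    g≤si = ≮⇒≥ (λ si<g → i⊀g (≤-<-trans i≤j (proj₁ j≺g) , si<g))
    j≺ : ∀ {x} → x ∈ W → (j , sj) ≺ x
    j≺ {x} x∈W with ∈-++⁻ E (All.lookup W∈ x∈W)
    ... | inj₂ x∈A = All.lookup j≺A x∈A
    ... | inj₁ x∈E with AllPairs-comparable W! x∈W g∈W
    ...   | inj₁ refl = contradiction (All.lookup E-exc x∈E) (<-asym (All.lookup A-anti g∈A))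
    ...   | inj₂ (inj₁ x≺g) = contradiction (<-trans (proj₂ (All.lookup i≺E x∈E)) (proj₂ x≺g)) (≤⇒≯ g≤si)
    ...   | inj₂ (inj₂ g≺x) = <-trans (proj₁ j≺g) (proj₁ g≺x) , ≤-<-trans sj≤si (proj₂ (All.lookup i≺E x∈E))

LongestChain : List Point → List Point → Set
LongestChain E A = ∃[ m ] MaxLength (ChainIn (E ++ A)) m × m + matchCount E A ≡ length E + length A

module _ {i si j sj : ℕ} {E A : List Point} (i≺E : All ((i , si) ≺_) E) (j≺A : All ((j , sj) ≺_) A)
         (i<si : i < si) (sj<j : sj < j) where

  private
    e a : Point
    e = (i , si)
    a = (j , sj)

  longestChain-skipAntiexcedance : j < i → LongestChain (e ∷ E) A → LongestChain (e ∷ E) (a ∷ A)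
  longestChain-skipAntiexcedance j<i (m , M , m+mc≡) = suc m , MaxLength-addMinimum S⊆T (∈-++⁺ʳ (e ∷ E) (here refl)) T⊆a∪S a≺S M , (begin
    suc m + matchCount (e ∷ E) (a ∷ A) ≡⟨ cong (suc m +_) (matchCount-skipAntiexcedance {E = E} {A} j<i) ⟩
    suc (m + matchCount (e ∷ E) A)     ≡⟨ cong suc m+mc≡ ⟩
    suc (length (e ∷ E) + length A)    ≡⟨ +-suc (length (e ∷ E)) (length A) ⟨
    length (e ∷ E) + length (a ∷ A)    ∎)
    where
    open ≡-Reasoning
    S⊆T : ∀ {x} → x ∈ (e ∷ E) ++ A → x ∈ (e ∷ E) ++ a ∷ A
    S⊆T = ∈-mid⁺ {L = e ∷ E}
    T⊆a∪S : ∀ {x} → x ∈ (e ∷ E) ++ a ∷ A → x ≡ a ⊎ x ∈ (e ∷ E) ++ A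
    T⊆a∪S = ∈-mid⁻ {L = e ∷ E}
    a≺e : a ≺ e
    a≺e = j<i , <-trans sj<j (<-trans j<i i<si)
    a≺S : ∀ {x} → x ∈ (e ∷ E) ++ A → a ≺ x
    a≺S x∈ with ∈-++⁻ (e ∷ E) x∈
    ... | inj₁ (here refl) = a≺e
    ... | inj₁ (there x∈E) = let (i<x , si<x) = All.lookup i≺E x∈E in <-trans j<i i<x , <-trans (proj₂ a≺e) si<x
    ... | inj₂ x∈A = All.lookup j≺A x∈A

  longestChain-skipExcedance : i ≤ j → si < sj → LongestChain E (a ∷ A) → LongestChain (e ∷ E) (a ∷ A)
  longestChain-skipExcedance i≤j si<sj (m , M , m+mc≡) = suc m , MaxLength-addMinimum there (here refl) T⊆e∪S e≺S M , (begin
    suc m + matchCount (e ∷ E) (a ∷ A) ≡⟨ cong (suc m +_) (matchCount-skipExcedance {E = E} {A} i≤j si<sj) ⟩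
    suc (m + matchCount E (a ∷ A))     ≡⟨ cong suc m+mc≡ ⟩
    length (e ∷ E) + length (a ∷ A)    ∎)
    where
    open ≡-Reasoning
    T⊆e∪S : ∀ {x} → x ∈ (e ∷ E) ++ a ∷ A → x ≡ e ⊎ x ∈ E ++ a ∷ A
    T⊆e∪S (here x≡e) = inj₁ x≡e
    T⊆e∪S (there x∈) = inj₂ x∈
    i<j : i < j
    i<j = ≤∧≢⇒< i≤j (λ { refl → <-asym si<sj (<-trans sj<j i<si) })
    e≺S : ∀ {x} → x ∈ E ++ a ∷ A → e ≺ x
    e≺S x∈ with ∈-mid⁻ {L = E} x∈
    ... | inj₁ refl = i<j , si<sj
    ... | inj₂ x∈E++A with ∈-++⁻ E x∈E++A
    ...   | inj₁ x∈E = All.lookup i≺E x∈E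
    ...   | inj₂ x∈A = let (j<x , sj<x) = All.lookup j≺A x∈A in <-trans i<j j<x , <-trans si<sj sj<x

  longestChain-match : i ≤ j → sj ≤ si → All IsExcedance E → All IsAntiexcedance A → LongestChain E A → LongestChain (e ∷ E) (a ∷ A)
  longestChain-match i≤j sj≤si E-exc A-anti (m , M , m+mc≡) =
    suc m , MaxLength-addIncomparable S⊆T (here refl) a∈T e≢a e⊀a a⊀e T⊆ea∪S M first , (begin
    suc m + matchCount (e ∷ E) (a ∷ A) ≡⟨ cong (suc m +_) (matchCount-match {E = E} {A} i≤j sj≤si) ⟩
    suc (m + suc (matchCount E A))     ≡⟨ cong suc (+-suc m (matchCount E A)) ⟩
    suc (suc (m + matchCount E A))     ≡⟨ cong (suc ∘ suc) m+mc≡ ⟩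
    suc (suc (length E + length A))    ≡⟨ cong suc (+-suc (length E) (length A)) ⟨
    length (e ∷ E) + length (a ∷ A)    ∎)
    where
    open ≡-Reasoning
    open MaxLength M
    S⊆T : ∀ {x} → x ∈ E ++ A → x ∈ (e ∷ E) ++ a ∷ A
    S⊆T = there ∘ ∈-mid⁺ {L = E}
    a∈T : a ∈ (e ∷ E) ++ a ∷ A
    a∈T = ∈-++⁺ʳ (e ∷ E) (here refl)
    T⊆ea∪S : ∀ {x} → x ∈ (e ∷ E) ++ a ∷ A → x ≡ e ⊎ x ≡ a ⊎ x ∈ E ++ A
    T⊆ea∪S (here x≡e) = inj₁ x≡e
    T⊆ea∪S (there x∈) = inj₂ (∈-mid⁻ {L = E} x∈)
    e≢a : e ≢ a
    e≢a refl = <-asym i<si sj<j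
    e⊀a : ¬ e ≺ a
    e⊀a (_ , si<sj) = ≤⇒≯ sj≤si si<sj
    a⊀e : ¬ a ≺ e
    a⊀e (j<i , _) = ≤⇒≯ i≤j j<i
    first : ∃[ p ] p ∈ (e ∷ E) ++ a ∷ A × All (p ≺_) witness
    first with matched-pair-precedes i≤j sj≤si i≺E j≺A E-exc A-anti witness-satisfies
    ... | inj₁ e≺W = e , here refl , e≺W
    ... | inj₂ a≺W = a , a∈T , a≺W

longestChain-∷ : ∀ {i si j sj E A} → AllPairs _≺_ ((i , si) ∷ E) → AllPairs _≺_ ((j , sj) ∷ A) →
  All IsExcedance ((i , si) ∷ E) → All IsAntiexcedance ((j , sj) ∷ A) →
  LongestChain ((i , si) ∷ E) A → LongestChain E ((j , sj) ∷ A) → LongestChain E A →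
  LongestChain ((i , si) ∷ E) ((j , sj) ∷ A)
longestChain-∷ {i} {si} {j} {sj} (i≺E ∷ _) (j≺A ∷ _) (i<si ∷ E-exc) (sj<j ∷ A-anti) without-a without-e without-both
  with j <? i
... | yes j<i = longestChain-skipAntiexcedance i≺E j≺A i<si sj<j j<i without-a
... | no j≮i with si <? sj
...   | yes si<sj = longestChain-skipExcedance i≺E j≺A i<si sj<j (≮⇒≥ j≮i) si<sj without-e
...   | no si≮sj = longestChain-match i≺E j≺A i<si sj<j (≮⇒≥ j≮i) (≮⇒≥ si≮sj) E-exc A-anti without-both

longestChain : ∀ E A → AllPairs _≺_ E → AllPairs _≺_ A → All IsExcedance E → All IsAntiexcedance A → LongestChain E A
longestChain [] A _ A! _ _ = length A , MaxLength-chain A! , +-identityʳ (length A)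
longestChain E@(_ ∷ _) [] E! _ _ _ =
  length E , subst (λ S → MaxLength (ChainIn S) (length E)) (sym (++-identityʳ E)) (MaxLength-chain E!) , refl
longestChain ((i , si) ∷ E) ((j , sj) ∷ A) E! A! E-exc A-anti = longestChain-∷ E! A! E-exc A-anti
  (longestChain ((i , si) ∷ E) A E! (AllPairs.tail A!) E-exc (All.tail A-anti))
  (longestChain E ((j , sj) ∷ A) (AllPairs.tail E!) A! (All.tail E-exc) A-anti)
  (longestChain E A (AllPairs.tail E!) (AllPairs.tail A!) (All.tail E-exc) (All.tail A-anti))

-- Permutations avoiding 321

smaller-after : ∀ {b v} P S → countBelow b (P ++ b ∷ S) ≡ b → length P < b → v ∈ P → b ≤ v → ∃[ x ] x ∈ S × x < b
smaller-after {b} P S all-below |P|<b v∈P b≤v = countBelow>0⇒∃ S (≰⇒> none-after)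
  where
  open ≤-Reasoning
  none-after : ¬ countBelow b S ≤ 0
  none-after S≤0 = <-irrefl refl (begin-strict
    b                                     ≡⟨ all-below ⟨
    countBelow b (P ++ b ∷ S)             ≡⟨ countBelow-++ b P (b ∷ S) ⟩
    countBelow b P + countBelow b (b ∷ S) ≡⟨ cong (countBelow b P +_) (trans (countBelow-≥ S ≤-refl) (n≤0⇒n≡0 S≤0)) ⟩
    countBelow b P + 0                    ≡⟨ +-identityʳ _ ⟩
    countBelow b P                        <⟨ countBelow<length P v∈P b≤v ⟩
    length P                              <⟨ |P|<b ⟩
    b                                     ∎)

larger-before : ∀ {b v} P S → countBelow (suc b) (P ++ b ∷ S) ≡ suc b → b < length P → v ∈ S → v < b → ∃[ x ] x ∈ P × b < x
larger-before {b} P S all-below b<|P| v∈S v<b = countBelow<length⇒∃ P (<-trans before<b b<|P|)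
  where
  open ≤-Reasoning
  before<b : countBelow (suc b) P < b
  before<b = s≤s⁻¹ (begin
    suc (suc (countBelow (suc b) P))                  ≡⟨ +-comm 2 _ ⟩
    countBelow (suc b) P + 2                          ≤⟨ +-monoʳ-≤ _ (s≤s (countBelow-pos S v∈S (m<n⇒m<1+n v<b))) ⟩
    countBelow (suc b) P + suc (countBelow (suc b) S) ≡⟨ cong (countBelow (suc b) P +_) (countBelow-< S ≤-refl) ⟨
    countBelow (suc b) P + countBelow (suc b) (b ∷ S) ≡⟨ countBelow-++ (suc b) P (b ∷ S) ⟨
    countBelow (suc b) (P ++ b ∷ S)                   ≡⟨ all-below ⟩
    suc b                                             ∎)

module Perm {n : ℕ} (σ : Permutation′ n) where

  value : Fin n → ℕ
  value i = toℕ (σ ⟨$⟩ʳ i)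

  position : Fin n → ℕ
  position v = toℕ (σ ⟨$⟩ˡ v)

  value-position : ∀ v → value (σ ⟨$⟩ˡ v) ≡ toℕ v
  value-position v = cong toℕ (inverseʳ σ)

  σ-injective : ∀ {i j} → value i ≡ value j → i ≡ j
  σ-injective {i} {j} eq = trans (sym (inverseˡ σ)) (trans (cong (σ ⟨$⟩ˡ_) (toℕ-injective eq)) (inverseˡ σ))

  oneLine≡ : oneLine σ ≡ tabulate value
  oneLine≡ = map-tabulate id value

  oneLine-distinct : AllPairs _≢_ (oneLine σ)
  oneLine-distinct = subst (AllPairs _≢_) (sym oneLine≡) (AllPairsₚ.tabulate⁺ (λ i≢j → i≢j ∘ σ-injective))

  oneLine-bounded : All (_< n) (oneLine σ)
  oneLine-bounded = subst (All (_< n)) (sym oneLine≡) (Allₚ.tabulate⁺ (λ i → toℕ<n (σ ⟨$⟩ʳ i)))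

  oneLine-complete : ∀ {v} → v < n → v ∈ oneLine σ
  oneLine-complete v<n = subst (_ ∈_) (sym oneLine≡)
    (subst (_∈ tabulate value) (trans (value-position (F.fromℕ< v<n)) (toℕ-fromℕ< v<n)) (∈-tabulate⁺ (σ ⟨$⟩ˡ F.fromℕ< v<n)))

  length-oneLine : length (oneLine σ) ≡ n
  length-oneLine = trans (length-map value (allFin n)) (length-tabulate id)

  countBelow-oneLine : ∀ k → k ≤ n → countBelow k (oneLine σ) ≡ k
  countBelow-oneLine zero _ = countBelow-zero (oneLine σ)
  countBelow-oneLine (suc k) k<n = trans (countBelow-suc-∈ (oneLine σ) oneLine-distinct (oneLine-complete k<n))
    (cong suc (countBelow-oneLine k (<⇒≤ k<n)))

  oneLine-avoids321 : Avoids321 σ → Avoids321List (oneLine σ)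
  oneLine-avoids321 avoids abc⊆ b<a c<b with ⊆-map-inv value (allFin n) abc⊆
  ... | i ∷ j ∷ k ∷ [] , ijk⊆ , refl with AllPairs-resp-⊆ ijk⊆ (AllPairsₚ.tabulate⁺-< id)
  ...   | (i<j ∷ _ ∷ []) ∷ (j<k ∷ []) ∷ _ = avoids i j k i<j j<k (b<a , c<b)

  position-injective : ∀ {v₁ v₂} → position v₁ ≡ position v₂ → v₁ ≡ v₂
  position-injective eq = trans (sym (inverseʳ σ)) (trans (cong (σ ⟨$⟩ʳ_) (toℕ-injective eq)) (inverseʳ σ))

  pattern321 : ∀ {P S a b c} → oneLine σ ≡ P ++ b ∷ S → a ∈ P → c ∈ S → a ∷ b ∷ c ∷ [] ⊆ oneLine σ
  pattern321 split a∈P c∈S = subst (_ ⊆_) (sym split) (++⁺ (from∈ a∈P) (refl ∷ from∈ c∈S))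

  record Split (v : Fin n) : Set where
    field
      before after : List ℕ
      oneLine≡split : oneLine σ ≡ before ++ value (σ ⟨$⟩ˡ v) ∷ after
      length-before : length before ≡ position v
      ∈-before : ∀ j → j F.< σ ⟨$⟩ˡ v → value j ∈ before
      ∈-after : ∀ j → σ ⟨$⟩ˡ v F.< j → value j ∈ after

    countBelow-split : ∀ k → k ≤ n → countBelow k (before ++ value (σ ⟨$⟩ˡ v) ∷ after) ≡ k
    countBelow-split k k≤n = trans (cong (countBelow k) (sym oneLine≡split)) (countBelow-oneLine k k≤n)

  split-at : ∀ v → Split v
  split-at v with tabulate-split value (σ ⟨$⟩ˡ v)
  ... | P , S , split , |P| , ∈P , ∈S = record
    { before = P ; after = S ; oneLine≡split = trans oneLine≡ split ; length-before = |P| ; ∈-before = ∈P ; ∈-after = ∈S }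

  -- If an excedance value v₁ stood right of a larger v₂, then fewer than v₁ slots precede it,
  -- one of them holding v₂, so some smaller value follows it: v₂ v₁ x is a 321.
  -- Dually for antiexcedances.
  module _ (avoids : Avoids321List (oneLine σ)) where

    excedance-positions-increase : ∀ {v₁ v₂ : Fin n} → toℕ v₁ < toℕ v₂ →
      position v₁ < toℕ v₁ → position v₁ < position v₂
    excedance-positions-increase {v₁} {v₂} v₁<v₂ exc₁ with <-cmp (position v₁) (position v₂)
    ... | tri< p₁<p₂ _ _ = p₁<p₂
    ... | tri≈ _ p₁≡p₂ _ = contradiction (cong toℕ (position-injective p₁≡p₂)) (<⇒≢ v₁<v₂)
    ... | tri> _ _ p₂<p₁ = refute (smaller-after before after (countBelow-split _ (subst (_≤ n) (sym b≡) (<⇒≤ (toℕ<n v₁))))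
        (subst₂ _<_ (sym length-before) (sym b≡) exc₁) v₂∈before (<⇒≤ b<v₂))
      where
      open Split (split-at v₁)
      b≡ : value (σ ⟨$⟩ˡ v₁) ≡ toℕ v₁
      b≡ = value-position v₁
      b<v₂ : value (σ ⟨$⟩ˡ v₁) < value (σ ⟨$⟩ˡ v₂)
      b<v₂ = subst₂ _<_ (sym b≡) (sym (value-position v₂)) v₁<v₂
      v₂∈before : value (σ ⟨$⟩ˡ v₂) ∈ before
      v₂∈before = ∈-before (σ ⟨$⟩ˡ v₂) p₂<p₁
      refute : ∃[ x ] x ∈ after × x < value (σ ⟨$⟩ˡ v₁) → position v₁ < position v₂
      refute (x , x∈after , x<b) = ⊥-elim (avoids (pattern321 oneLine≡split v₂∈before x∈after) b<v₂ x<b)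

    antiexcedance-positions-increase : ∀ {v₁ v₂ : Fin n} → toℕ v₁ < toℕ v₂ →
      toℕ v₂ < position v₂ → position v₁ < position v₂
    antiexcedance-positions-increase {v₁} {v₂} v₁<v₂ anti₂ with <-cmp (position v₁) (position v₂)
    ... | tri< p₁<p₂ _ _ = p₁<p₂
    ... | tri≈ _ p₁≡p₂ _ = contradiction (cong toℕ (position-injective p₁≡p₂)) (<⇒≢ v₁<v₂)
    ... | tri> _ _ p₂<p₁ = refute (larger-before before after (countBelow-split _ (subst (_≤ n) (sym (cong suc b≡)) (toℕ<n v₂)))
        (subst₂ _<_ (sym b≡) (sym length-before) anti₂) v₁∈after v₁<b)
      where
      open Split (split-at v₂)
      b≡ : value (σ ⟨$⟩ˡ v₂) ≡ toℕ v₂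
      b≡ = value-position v₂
      v₁<b : value (σ ⟨$⟩ˡ v₁) < value (σ ⟨$⟩ˡ v₂)
      v₁<b = subst₂ _<_ (sym (value-position v₁)) (sym b≡) v₁<v₂
      v₁∈after : value (σ ⟨$⟩ˡ v₁) ∈ after
      v₁∈after = ∈-after (σ ⟨$⟩ˡ v₁) p₂<p₁
      refute : ∃[ x ] x ∈ before × value (σ ⟨$⟩ˡ v₂) < x → position v₁ < position v₂
      refute (x , x∈before , b<x) = ⊥-elim (avoids (pattern321 oneLine≡split x∈before v₁∈after) b<x v₁<b)

module Points {n : ℕ} (σ : Permutation′ n) where
  open Perm σ

  point : Fin n → Point
  point v = (position v , toℕ v)

  pointIf : Bool → Fin n → List Point
  pointIf b v = if b then point v ∷ [] else []

  ∈-pointIf : ∀ {b v p} → p ∈ pointIf b v → T b × p ≡ point v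
  ∈-pointIf {true} (here refl) = tt , refl

  pointsWhere : (Fin n → Bool) → List Point
  pointsWhere b = concatMap (λ v → pointIf (b v) v) (allFin n)

  ∈-pointsWhere⁻ : ∀ {b p} → p ∈ pointsWhere b → ∃[ v ] T (b v) × p ≡ point v
  ∈-pointsWhere⁻ {b} p∈ = let (v , _ , p∈v) = find (∈-concatMap⁻ (λ v → pointIf (b v) v) {xs = allFin n} p∈) in v , ∈-pointIf p∈v

  ∈-pointsWhere⁺ : ∀ {b v} → T (b v) → point v ∈ pointsWhere b
  ∈-pointsWhere⁺ {b} {v} bv = ∈-concatMap⁺ (λ v → pointIf (b v) v) {xs = allFin n} (Any.map (λ { refl → here-if bv }) (∈-allFin v))
    where
    here-if : ∀ {c} → T c → point v ∈ pointIf c v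
    here-if {true} _ = here refl

  pointsWhere-All : ∀ {b} {P : Point → Set} → (∀ {v} → T (b v) → P (point v)) → All P (pointsWhere b)
  pointsWhere-All {b} {P} P-point = All.tabulate λ p∈ → let (v , bv , p≡) = ∈-pointsWhere⁻ p∈ in subst P (sym p≡) (P-point bv)

  pointsWhere-chain : ∀ {b} → (∀ {v₁ v₂} → toℕ v₁ < toℕ v₂ → T (b v₁) → T (b v₂) → position v₁ < position v₂) →
    AllPairs _≺_ (pointsWhere b)
  pointsWhere-chain {b} increase = concatMap-AllPairs (λ v → pointIf (b v) v) singleton cross (AllPairsₚ.tabulate⁺-< id)
    where
    singleton : ∀ v → AllPairs _≺_ (pointIf (b v) v)
    singleton v with b v
    ... | true = [] ∷ []
    ... | false = []
    cross : ∀ {v₁ v₂} → v₁ F.< v₂ → ∀ {p q} → p ∈ pointIf (b v₁) v₁ → q ∈ pointIf (b v₂) v₂ → p ≺ q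
    cross v₁<v₂ p∈ q∈ with ∈-pointIf p∈ | ∈-pointIf q∈
    ... | b₁ , refl | b₂ , refl = increase v₁<v₂ b₁ b₂ , v₁<v₂

  isExcedanceᵇ : Fin n → Bool
  isExcedanceᵇ v = position v <ᵇ toℕ v

  isAntiexcedanceᵇ : Fin n → Bool
  isAntiexcedanceᵇ v = toℕ v <ᵇ position v

  Ex An : List Point
  Ex = pointsWhere isExcedanceᵇ
  An = pointsWhere isAntiexcedanceᵇ

  matchedPairs≡ : matchedPairs σ ≡ matchCount Ex An
  matchedPairs≡ = cong₂ matchCount (concatMap-cong (λ _ → refl) (allFin n)) (concatMap-cong (λ _ → refl) (allFin n))

  module _ (avoids : Avoids321List (oneLine σ)) where

    Ex-chain : AllPairs _≺_ Ex
    Ex-chain = pointsWhere-chain (λ v₁<v₂ e₁ _ → excedance-positions-increase avoids v₁<v₂ (<ᵇ⇒< _ _ e₁))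

    An-chain : AllPairs _≺_ An
    An-chain = pointsWhere-chain (λ v₁<v₂ _ a₂ → antiexcedance-positions-increase avoids v₁<v₂ (<ᵇ⇒< _ _ a₂))

  Ex-excedances : All IsExcedance Ex
  Ex-excedances = pointsWhere-All (<ᵇ⇒< _ _)

  An-antiexcedances : All IsAntiexcedance An
  An-antiexcedances = pointsWhere-All (<ᵇ⇒< _ _)

  graph : List Point
  graph = tabulate (λ i → (toℕ i , value i))

  point∈graph : ∀ v → point v ∈ graph
  point∈graph v = subst (_∈ graph) (cong (position v ,_) (value-position v)) (∈-tabulate⁺ (σ ⟨$⟩ˡ v))

  Ex++An⊆graph : ∀ {x} → x ∈ Ex ++ An → x ∈ graph
  Ex++An⊆graph x∈ with ∈-++⁻ Ex x∈
  ... | inj₁ x∈Ex with ∈-pointsWhere⁻ x∈Ex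
  ...   | v , _ , refl = point∈graph v
  Ex++An⊆graph x∈ | inj₂ x∈An with ∈-pointsWhere⁻ x∈An
  ...   | v , _ , refl = point∈graph v

  position-σ : ∀ i → position (σ ⟨$⟩ʳ i) ≡ toℕ i
  position-σ i = cong toℕ (inverseˡ σ)

  point-σ : ∀ i → point (σ ⟨$⟩ʳ i) ≡ (toℕ i , value i)
  point-σ i = cong (_, value i) (position-σ i)

  graph⊆Ex++An : FixedPointFree σ → ∀ {x} → x ∈ graph → x ∈ Ex ++ An
  graph⊆Ex++An fixed-point-free x∈ with ∈-tabulate⁻ x∈
  ... | i , refl with <-cmp (toℕ i) (value i)
  ...   | tri< i<σi _ _ = ∈-++⁺ˡ (subst (_∈ Ex) (point-σ i)
          (∈-pointsWhere⁺ (<⇒<ᵇ (subst (_< value i) (sym (position-σ i)) i<σi))))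
  ...   | tri≈ _ i≡σi _ = contradiction (toℕ-injective (sym i≡σi)) (fixed-point-free i)
  ...   | tri> _ _ σi<i = ∈-++⁺ʳ Ex (subst (_∈ An) (point-σ i)
          (∈-pointsWhere⁺ (<⇒<ᵇ (subst (value i <_) (sym (position-σ i)) σi<i))))

  length-Ex+An : FixedPointFree σ → length Ex + length An ≡ n
  length-Ex+An fixed-point-free = trans (split-lengths (allFin n)) (length-tabulate id)
    where
    exactly-one : ∀ v → length (pointIf (isExcedanceᵇ v) v) + length (pointIf (isAntiexcedanceᵇ v) v) ≡ 1
    exactly-one v with <-cmp (position v) (toℕ v)
    ... | tri< p<v _ _ rewrite <ᵇ-true p<v | <ᵇ-false (<⇒≤ p<v) = refl
    ... | tri≈ _ p≡v _ = contradiction (trans (inverseʳ σ) (sym (toℕ-injective p≡v))) (fixed-point-free (σ ⟨$⟩ˡ v))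
    ... | tri> _ _ v<p rewrite <ᵇ-false (<⇒≤ v<p) | <ᵇ-true v<p = refl
    split-lengths : ∀ vs → length (concatMap (λ v → pointIf (isExcedanceᵇ v) v) vs)
                         + length (concatMap (λ v → pointIf (isAntiexcedanceᵇ v) v) vs) ≡ length vs
    split-lengths [] = refl
    split-lengths (v ∷ vs) = begin
      length (E₁ ++ Es) + length (A₁ ++ As)               ≡⟨ cong₂ _+_ (length-++ E₁) (length-++ A₁) ⟩
      (length E₁ + length Es) + (length A₁ + length As)   ≡⟨ interchange (length E₁) (length Es) (length A₁) (length As) ⟩
      (length E₁ + length A₁) + (length Es + length As)   ≡⟨ cong₂ _+_ (exactly-one v) (split-lengths vs) ⟩
      suc (length vs)                                     ∎
      where
      open ≡-Reasoning
      E₁ A₁ Es As : List Point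
      E₁ = pointIf (isExcedanceᵇ v) v
      A₁ = pointIf (isAntiexcedanceᵇ v) v
      Es = concatMap (λ v → pointIf (isExcedanceᵇ v) v) vs
      As = concatMap (λ v → pointIf (isAntiexcedanceᵇ v) v) vs

  graph-sorted : AllPairs (λ p q → proj₁ p < proj₁ q) graph
  graph-sorted = AllPairsₚ.tabulate⁺-< id

  values-graph : map proj₂ graph ≡ oneLine σ
  values-graph = trans (map-tabulate _ proj₂) (sym oneLine≡)

  chain⇒increasing : ∀ {C} → ChainIn graph C → IncreasingSublist (oneLine σ) (map proj₂ C)
  chain⇒increasing (C! , C∈) =
    subst (map proj₂ _ ⊆_) values-graph (map⁺ proj₂ (sortedSubset⇒sublist (λ p<q q<p → <-asym p<q q<p) (AllPairs.map proj₁ C!) graph-sorted C∈))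
    , AllPairsₚ.map⁺ (AllPairs.map proj₂ C!)

  increasing⇒chain : ∀ {s} → IncreasingSublist (oneLine σ) s → ∃[ C ] ChainIn graph C × length C ≡ length s
  increasing⇒chain (s⊆ , s!) with ⊆-map-inv proj₂ graph (subst (_ ⊆_) (sym values-graph) s⊆)
  ... | C , C⊆ , refl =
    C , (AllPairs.zip (AllPairs-resp-⊆ C⊆ graph-sorted , AllPairsₚ.map⁻ s!) , All.tabulate (Any-resp-⊆ C⊆)) , sym (length-map proj₂ C)

  lis≡longestChain : FixedPointFree σ → ∀ {m} → MaxLength (ChainIn (Ex ++ An)) m → lis σ ≡ m
  lis≡longestChain fixed-point-free M = lis-MaxLength σ (MaxLength-transfer to-increasing to-chain M)
    where
    to-increasing : ∀ {C} → ChainIn (Ex ++ An) C → ∃[ s ] IncreasingSublist (oneLine σ) s × length s ≡ length C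
    to-increasing {C} (C! , C∈) = map proj₂ C , chain⇒increasing (C! , All.map Ex++An⊆graph C∈) , length-map proj₂ C
    to-chain : ∀ {s} → IncreasingSublist (oneLine σ) s → ∃[ C ] ChainIn (Ex ++ An) C × length C ≡ length s
    to-chain s-ok with increasing⇒chain s-ok
    ... | C , (C! , C∈) , len = C , (C! , All.map (graph⊆Ex++An fixed-point-free) C∈) , len

  lis+matchedPairs : Avoids321List (oneLine σ) → FixedPointFree σ → lis σ + matchedPairs σ ≡ n
  lis+matchedPairs avoids fixed-point-free with longestChain Ex An (Ex-chain avoids) (An-chain avoids) Ex-excedances An-antiexcedances
  ... | m , M , m+mc≡ = trans (cong₂ _+_ (lis≡longestChain fixed-point-free M) matchedPairs≡) (trans m+mc≡ (length-Ex+An fixed-point-free))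

module DyckWord {n r₁ r₂ q₁ q₂} (P : StandardRows n r₁ r₂) (Q : StandardRows n q₁ q₂) where
  open StandardRows

  path : List Step
  path = word P ++ reversal (word Q)

  length-word : ∀ {r r′} (R : StandardRows n r r′) → length (word R) ≡ n
  length-word {r} _ = length-applyUpTo (letter r) n

  length-path : length path ≡ n + n
  length-path = trans (length-++ (word P)) (cong₂ _+_ (length-word P)
    (trans (length-reverse (map flip (word Q))) (trans (length-map flip (word Q)) (length-word Q))))

  take-path : take n path ≡ word P
  take-path = trans (cong (λ k → take k path) (sym (length-word P))) (take-++ˡ (word P))
    where
    take-++ˡ : ∀ (X : List Step) {Y} → take (length X) (X ++ Y) ≡ X
    take-++ˡ [] = refl
    take-++ˡ (s ∷ X) = cong (s ∷_) (take-++ˡ X)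

  height : he n path ≡ ℤ.+ countBelow n r₁ ℤ.- ℤ.+ countBelow n r₂
  height = trans (cong (λ X → ℤ.+ count u X ℤ.- ℤ.+ count d X) take-path)
    (cong₂ (λ a b → ℤ.+ a ℤ.- ℤ.+ b) (count-u-prefix P n) (count-d-prefix P n ≤-refl))

  leftSide : leftSideTunnels n path ≡ countBelow n r₂
  leftSide = begin
    leftSideTunnels n path                                  ≡⟨ leftSideTunnels≡ n path _ (λ _ _ _ → refl) length-path ⟩
    length (filter (endsBy? n) (tunnelList path))           ≡⟨ cong (λ k → length (filter (endsBy? k) (tunnelList path))) (length-word P) ⟨
    length (filter (endsBy? (length (word P))) (tunnelList path)) ≡⟨ cong length (filter-endsBy (word P) (reversal (word Q))) ⟩
    length (map (extendBy (reversal (word Q))) (tunnelList (word P))) ≡⟨ length-map _ (tunnelList (word P)) ⟩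
    tunnelCount (word P)                                    ≡⟨ tunnelCount-ballot (word P) (word-ballot P) ⟩
    count d (word P)                                        ≡⟨ count-d-prefix P n ≤-refl ⟩
    countBelow n r₂                                         ∎
    where open ≡-Reasoning

  rightSide : rightSideTunnels n path ≡ countBelow n q₂
  rightSide = begin
    rightSideTunnels n path                                 ≡⟨ rightSideTunnels≡ n path _ (λ _ _ _ → refl) length-path ⟩
    length (filter (startsFrom? n) (tunnelList path))       ≡⟨ cong (λ k → length (filter (startsFrom? k) (tunnelList path))) (length-word P) ⟨
    length (filter (startsFrom? (length (word P))) (tunnelList path)) ≡⟨ cong length (filter-startsFrom (word P) (reversal (word Q))) ⟩
    length (map (shiftBy (word P)) (tunnelList (reversal (word Q)))) ≡⟨ length-map _ (tunnelList (reversal (word Q))) ⟩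
    tunnelCount (reversal (word Q))                         ≡⟨ tunnelCount-coballot _ (reversal-coballot Q) ⟩
    count u (reversal (word Q))                             ≡⟨ count-u-reversed-word Q ⟩
    countBelow n q₂                                         ∎
    where open ≡-Reasoning

record TwoRowRSK {n} (σ : Permutation′ n) : Set where
  field
    r₁ r₂ q₁ q₂ : List ℕ
    RSK≡ : RSK σ ≡ (twoRow r₁ r₂ , twoRow q₁ q₂)
    P-rows : StandardRows n r₁ r₂
    Q-rows : StandardRows n q₁ q₂
    countBelow-row₁ : countBelow n r₁ ≡ length r₁
    countBelow-row₂ : countBelow n r₂ ≡ length r₂
    countBelow-recording₂ : countBelow n q₂ ≡ length r₂
    lis≡row₁ : lis σ ≡ length r₁
    length-rows : length r₁ + length r₂ ≡ n
    shape₂ : length q₂ ≡ length r₂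

twoRowRSK : ∀ {n} (σ : Permutation′ (suc n)) → Avoids321 σ → TwoRowRSK σ
twoRowRSK {n} σ avoids = record
  { r₁ = r₁ ; r₂ = r₂ ; q₁ = q₁ ; q₂ = q₂
  ; RSK≡ = rsFrom≡
  ; P-rows = record
    { distinct₁ = AllPairs.map <⇒≢ sorted₁
    ; partition = λ k k≤n → trans (countBelow-rows k) (countBelow-oneLine k k≤n)
    ; ballot = ballot }
  ; Q-rows = record
    { distinct₁ = AllPairs.map <⇒≢ (RecordingInv.sorted₁ recording)
    ; partition = λ k k≤n → RecordingInv.partition recording k (subst (k ≤_) (sym length-oneLine) k≤n)
    ; ballot = RecordingInv.ballot recording }
  ; countBelow-row₁ = countBelow-all (All.tabulate (All.lookup oneLine-bounded ∘ row₁⊆))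
  ; countBelow-row₂ = countBelow-all (All.tabulate (All.lookup oneLine-bounded ∘ row₂⊆))
  ; countBelow-recording₂ = trans (RecordingInv.countBelow-beyond₂ recording (≤-reflexive length-oneLine)) shape₂
  ; lis≡row₁ = trans (lis-MaxLength σ (MaxLength-transfer drop-bound add-bound (schensted (suc n))))
      (countBelow-all (All.tabulate (All.lookup oneLine-bounded ∘ row₁⊆)))
  ; length-rows = trans length-rows length-oneLine
  ; shape₂ = shape₂ }
  where
  open Perm σ
  open RSOutcome (rs-twoRow oneLine-distinct (oneLine-avoids321 avoids) refl)
  open RSInv invariant
  open RowsInv rows
  drop-bound : ∀ {s} → IncreasingBelow (suc n) (oneLine σ) s → ∃[ t ] IncreasingSublist (oneLine σ) t × length t ≡ length s
  drop-bound (inc , _) = _ , inc , refl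
  add-bound : ∀ {s} → IncreasingSublist (oneLine σ) s → ∃[ t ] IncreasingBelow (suc n) (oneLine σ) t × length t ≡ length s
  add-bound inc@(s⊆ , _) = _ , (inc , All-resp-⊆ s⊆ oneLine-bounded) , refl

rowWord-twoRow : ∀ n r₁ r₂ → rowWord n (twoRow r₁ r₂) ≡ applyUpTo (letter r₁) n
rowWord-twoRow n r₁ r₂ = trans (rowWord≡ n (twoRow r₁ r₂)) (cong (λ r → applyUpTo (letter r) n) (firstRow-twoRow r₁ r₂))

sum-minus-difference : ∀ (x y : ℤ.ℤ) → (x ℤ.+ y) ℤ.- (x ℤ.- y) ≡ ℤ.+ 2 ℤ.* y
sum-minus-difference = solve-∀

module SecondRow {n} (σ : Permutation′ (suc n)) (avoids : Avoids321 σ) (fixed-point-free : FixedPointFree σ) where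
  open TwoRowRSK (twoRowRSK σ avoids) public
  open DyckWord P-rows Q-rows public

  lis+matchedPairs≡n : lis σ + matchedPairs σ ≡ suc n
  lis+matchedPairs≡n = Points.lis+matchedPairs σ (Perm.oneLine-avoids321 σ avoids) fixed-point-free

  row₂≡matchedPairs : length r₂ ≡ matchedPairs σ
  row₂≡matchedPairs = +-cancelˡ-≡ (lis σ) _ _ (trans (cong (_+ length r₂) lis≡row₁) (trans length-rows (sym lis+matchedPairs≡n)))

  Φ≡path : Φ σ ≡ path
  Φ≡path = trans (cong (λ PQ → rowWord (suc n) (proj₁ PQ) ++ reversal (rowWord (suc n) (proj₂ PQ))) RSK≡)
    (cong₂ (λ X Y → X ++ reversal Y) (rowWord-twoRow (suc n) r₁ r₂) (rowWord-twoRow (suc n) q₁ q₂))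

  n∸lis≡matchedPairs : suc n ∸ lis σ ≡ matchedPairs σ
  n∸lis≡matchedPairs = trans (cong (_∸ lis σ) (sym lis+matchedPairs≡n)) (m+n∸m≡n (lis σ) (matchedPairs σ))

  height-deficit : ℤ.+ suc n ℤ.- he (suc n) (Φ σ) ≡ ℤ.+ (2 * matchedPairs σ)
  height-deficit = begin
    ℤ.+ suc n ℤ.- he (suc n) (Φ σ)
      ≡⟨ cong₂ (λ k D → ℤ.+ k ℤ.- he (suc n) D) (sym length-rows) Φ≡path ⟩
    ℤ.+ (length r₁ + length r₂) ℤ.- he (suc n) path
      ≡⟨ cong (λ h → ℤ.+ (length r₁ + length r₂) ℤ.- h)
           (trans height (cong₂ (λ a b → ℤ.+ a ℤ.- ℤ.+ b) countBelow-row₁ countBelow-row₂)) ⟩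
    ℤ.+ (length r₁ + length r₂) ℤ.- (ℤ.+ length r₁ ℤ.- ℤ.+ length r₂)
      ≡⟨ cong (λ s → s ℤ.- (ℤ.+ length r₁ ℤ.- ℤ.+ length r₂)) (pos-+ (length r₁) (length r₂)) ⟩
    (ℤ.+ length r₁ ℤ.+ ℤ.+ length r₂) ℤ.- (ℤ.+ length r₁ ℤ.- ℤ.+ length r₂)
      ≡⟨ sum-minus-difference (ℤ.+ length r₁) (ℤ.+ length r₂) ⟩
    ℤ.+ 2 ℤ.* ℤ.+ length r₂
      ≡⟨ pos-* 2 (length r₂) ⟨
    ℤ.+ (2 * length r₂)
      ≡⟨ cong (λ k → ℤ.+ (2 * k)) row₂≡matchedPairs ⟩
    ℤ.+ (2 * matchedPairs σ) ∎
    where open ≡-Reasoning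

open import Data.Integer using (+_; _-_)

lemma1 : (n : ℕ) → 1 ≤ n → (σ : Permutation′ n) → Avoids321 σ → FixedPointFree σ →
    (rowLength 1 (proj₁ (RSK σ)) ≡ matchedPairs σ)
    × (rowLength 1 (proj₂ (RSK σ)) ≡ matchedPairs σ)
    × (rightSideTunnels n (Φ σ) ≡ matchedPairs σ)
    × (leftSideTunnels n (Φ σ) ≡ matchedPairs σ)
    × ((+ n) - he n (Φ σ) ≡ + (2 * matchedPairs σ))
    × (n ∸ lis σ ≡ matchedPairs σ)
lemma1 (suc n) _ σ avoids fixed-point-free =
    trans (cong (rowLength 1 ∘ proj₁) RSK≡) (trans (rowLength-twoRow r₁ r₂) row₂≡matchedPairs)
  , trans (cong (rowLength 1 ∘ proj₂) RSK≡) (trans (rowLength-twoRow q₁ q₂) (trans shape₂ row₂≡matchedPairs))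
  , trans (cong (rightSideTunnels (suc n)) Φ≡path) (trans rightSide (trans countBelow-recording₂ row₂≡matchedPairs))
  , trans (cong (leftSideTunnels (suc n)) Φ≡path) (trans leftSide (trans countBelow-row₂ row₂≡matchedPairs))
  , height-deficit
  , n∸lis≡matchedPairs
  where open SecondRow σ avoids fixed-point-free
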